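{- Let $K$ be a field with $\mathrm{char}(K)=0$, $a\in K$ with $a\neq0$, and let $D_n(x,a)=\sum_{j=0}^{\lfloor n/2\rfloor}\frac{n}{n-j}\binom{n-j}{j}(-a)^jx^{n-2j}$ be the $n$-th Dickson polynomial with parameter $a$. If $n\geq 4$, there exist two distinct critical points of $D_n(x,a)$ with equal critical values. If $n\geq 6$, there exist three distinct critical points of $D_n(x,a)$ with equal critical values.
   Context: Critical points of a polynomial are the roots of its derivative (with respect to $x$) in an algebraic closure of $K$; critical values are its values at these points. -}

module Defs where

open import Level using (Level; _⊔_) renaming (suc to lsuc)
open import Data.Nat as ℕ using (ℕ; zero; suc; _∸_; _≤_)
open import Data.Nat.DivMod using (_/_)
open import Data.Nat.Combinatorics using (_C_)
open import Data.List using (List; []; _∷_; [_]; _++_; replicate; map; upTo; foldr)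
open import Data.List.Relation.Unary.All using (All)
open import Data.Product using (Σ; ∃; _×_; _,_)
open import Relation.Nullary using (¬_)
open import Data.Unit using (⊤)
open import Algebra.Bundles using (CommutativeRing)
open import Algebra.Morphism.Structures using (module RingMorphisms)

record Field (c ℓ : Level) : Set (lsuc (c ⊔ ℓ)) where
  field
    commutativeRing : CommutativeRing c ℓ
  open CommutativeRing commutativeRing public
  field
    0≉1     : ¬ (0# ≈ 1#)
    inverse : ∀ x → ¬ (x ≈ 0#) → ∃ λ y → (x * y) ≈ 1#

module FieldOps {c ℓ : Level} (F : Field c ℓ) where
  open Field F

  _·_ : ℕ → Carrier → Carrier
  zero  · x = 0#
  suc n · x = x + (n · x)

  _^_ : Carrier → ℕ → Carrier
  x ^ zero  = 1#
  x ^ suc n = x * (x ^ n)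

  CharZero : Set ℓ
  CharZero = ∀ n → ¬ ((suc n · 1#) ≈ 0#)

  -- Polynomials in one variable x: coefficient lists, lowest degree first.
  Poly : Set c
  Poly = List Carrier

  _⊕_ : Poly → Poly → Poly
  []       ⊕ q        = q
  (p ∷ ps) ⊕ []       = p ∷ ps
  (p ∷ ps) ⊕ (q ∷ qs) = (p + q) ∷ (ps ⊕ qs)

  monomial : ℕ → Carrier → Poly
  monomial k c = replicate k 0# ++ [ c ]

  eval : Poly → Carrier → Carrier
  eval []       x = 0#
  eval (p ∷ ps) x = p + (x * eval ps x)

  derivFrom : ℕ → Poly → Poly
  derivFrom i []       = []
  derivFrom i (p ∷ ps) = (i · p) ∷ derivFrom (suc i) ps

  deriv : Poly → Poly
  deriv []       = []
  deriv (_ ∷ ps) = derivFrom 1 ps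

  IsConstant : Poly → Set (c ⊔ ℓ)
  IsConstant []       = Level.Lift (c ⊔ ℓ) ⊤
  IsConstant (_ ∷ ps) = All (λ c → c ≈ 0#) ps

  AlgebraicallyClosed : Set (c ⊔ ℓ)
  AlgebraicallyClosed = ∀ (p : Poly) → ¬ IsConstant p → ∃ λ x → eval p x ≈ 0#

  -- Dickson coefficient n/(n-j) * binom(n-j, j), an integer for 0 ≤ j ≤ ⌊n/2⌋, n ≥ 1
  -- (computed as the exact natural-number quotient n * binom(n-j,j) / (n-j)).
  dicksonCoeff : ℕ → ℕ → ℕ
  dicksonCoeff n j with n ∸ j
  ... | zero  = 0
  ... | suc m = (n ℕ.* (suc m C j)) / suc m

  dickson : ℕ → Carrier → Poly
  dickson n a =
    foldr (λ j acc → monomial (n ∸ (2 ℕ.* j)) (dicksonCoeff n j · ((- a) ^ j)) ⊕ acc)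
          []
          (upTo (suc (n / 2)))

-- Critical points of D_n(x,a) ∈ K[x], taken in an algebraically closed field L
-- containing K via the (necessarily injective) ring homomorphism f : K → L.
module DicksonCritical {c ℓ c′ ℓ′ : Level}
    (K : Field c ℓ) (L : Field c′ ℓ′)
    (f : Field.Carrier K → Field.Carrier L)
    (n : ℕ) (a : Field.Carrier K) where
  open FieldOps K using (dickson)
  open FieldOps L using (eval; deriv; Poly)

  D : Poly
  D = map f (dickson n a)

  IsCriticalPoint : Field.Carrier L → Set ℓ′
  IsCriticalPoint x = Field._≈_ L (eval (deriv D) x) (Field.0# L)

  criticalValue : Field.Carrier L → Field.Carrier L
  criticalValue x = eval D x

IsRingHom : ∀ {c ℓ c′ ℓ′} (K : Field c ℓ) (L : Field c′ ℓ′) →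
            (Field.Carrier K → Field.Carrier L) → Set (c ⊔ ℓ ⊔ ℓ′)
IsRingHom K L f =
  RingMorphisms.IsRingHomomorphism (Field.rawRing K) (Field.rawRing L) f

module Submission where

-- Write A = f(a) and choose s ∈ L with s² = A.  The Dickson polynomial
-- satisfies the functional equation Dₙ(u + v) = uⁿ + vⁿ whenever u·v = A,
-- and, differentiating, (u - v)·Dₙ′(u + v) = n·(uⁿ - vⁿ).  For a root τ ≠ ±1
-- of τⁿ = γ, where γ = ±1, take u = sτ and v = sτ⁻¹: then u ≠ v and
-- uⁿ = vⁿ, so x = u + v is a critical point, with critical value 2γsⁿ
-- independent of τ.  Distinct pairs {τ, τ⁻¹} give distinct points, and in
-- characteristic 0 the equation τⁿ = γ has n distinct roots in the
-- algebraically closed field L: enough for two pairs avoiding ±1 when n ≥ 4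
-- and three when n ≥ 6.

open import Defs
open import Level using (Level; _⊔_; Lift; lift)
open import Data.Nat using (ℕ; _≤_)
open import Data.Product using (∃; _×_)
open import Relation.Nullary using (¬_)

open import Algebra.Bundles using (CommutativeRing; RawRing)
open import Algebra.Morphism.Structures using (module RingMorphisms)
open import Data.Nat as ℕ using (zero; suc; _∸_; _<_; z≤n; s≤s)
import Data.Nat.Properties as ℕₚ
open import Data.Integer as ℤ using (ℤ; +_; -[1+_]; _◃_; _⊖_; sign; ∣_∣)
import Data.Integer.Properties as ℤ
open import Data.Sign as Sign using (Sign)
open import Data.Product using (_,_; proj₁; proj₂)
open import Data.Sum using (_⊎_; inj₁; inj₂)
open import Data.Maybe using (Maybe; just; nothing)
open import Data.Empty using (⊥)
open import Relation.Nullary using (yes; no)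
open import Relation.Binary.PropositionalEquality as ≡ using (_≡_)
open import Function using (_∘_)
open import Data.List using (List; []; _∷_; [_]; length; map)
open import Data.List.Relation.Binary.Pointwise using (Pointwise; []; _∷_)
open import Data.List.Relation.Unary.All as All using (All; []; _∷_)
open import Data.List.Relation.Unary.All.Properties using (¬Any⇒All¬)
open import Data.List.Relation.Unary.Any using (Any; here; there)
open import Data.List.Relation.Unary.AllPairs using (AllPairs; []; _∷_)
import Algebra.Solver.Ring.AlmostCommutativeRing as ACR
import Algebra.Solver.Ring as RingSolver

-- The ring solver of the standard library, instantiated with integer
-- coefficients for an arbitrary commutative ring: the integers are
-- interpreted through the canonical ring homomorphism ℤ → R.
module IntegerSolver {c ℓ} (R : CommutativeRing c ℓ) where
  open CommutativeRing R
  open import Algebra.Properties.Ring ring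
    using (-‿involutive; -‿distribˡ-*; -0#≈0#; -‿+-comm; ⁻¹-anti-homo‿-)
  open import Algebra.Properties.Semiring.Mult.TCOptimised semiring using (×-homo-+; ×1-homo-*; 1+×)
    renaming (_×_ to _×ᴿ_)
  open import Algebra.Properties.CommutativeSemigroup *-commutativeSemigroup
    using () renaming (interchange to *-interchange)
  open import Relation.Binary.Reasoning.Setoid setoid

  ι : ℕ → Carrier
  ι n = n ×ᴿ 1#

  ⟦_⟧ℤ : ℤ → Carrier
  ⟦ + n ⟧ℤ     = ι n
  ⟦ -[1+ n ] ⟧ℤ = - ι (suc n)

  ι-cong : ∀ {m n} → m ≡ n → ι m ≈ ι n
  ι-cong ≡.refl = refl

  ι-suc : ∀ n → ι (suc n) ≈ 1# + ι n
  ι-suc n = 1+× n 1#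

  ι-+ : ∀ m n → ι (m ℕ.+ n) ≈ ι m + ι n
  ι-+ = ×-homo-+ 1#

  private
    ι-∸ : ∀ {m n} → n ≤ m → ι (m ∸ n) ≈ ι m - ι n
    ι-∸ {m} {n} n≤m = begin
      ι (m ∸ n)                  ≈⟨ sym (+-identityʳ _) ⟩
      ι (m ∸ n) + 0#             ≈⟨ +-congˡ (sym (-‿inverseʳ (ι n))) ⟩
      ι (m ∸ n) + (ι n - ι n)    ≈⟨ sym (+-assoc _ _ _) ⟩
      (ι (m ∸ n) + ι n) - ι n    ≈⟨ +-congʳ (sym (ι-+ (m ∸ n) n)) ⟩
      ι (m ∸ n ℕ.+ n) - ι n      ≈⟨ +-congʳ (ι-cong (ℕₚ.m∸n+n≡m n≤m)) ⟩
      ι m - ι n                  ∎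

    ⟦-+n⟧ : ∀ n → ⟦ ℤ.- (+ n) ⟧ℤ ≈ - ι n
    ⟦-+n⟧ zero    = sym -0#≈0#
    ⟦-+n⟧ (suc n) = refl

    ⊖-homo : ∀ m n → ⟦ m ⊖ n ⟧ℤ ≈ ι m - ι n
    ⊖-homo m n with ℕₚ.≤-total n m
    ... | inj₁ n≤m = trans (reflexive (≡.cong ⟦_⟧ℤ (ℤ.⊖-≥ n≤m))) (ι-∸ n≤m)
    ... | inj₂ m≤n = begin
      ⟦ m ⊖ n ⟧ℤ               ≡⟨ ≡.cong ⟦_⟧ℤ (ℤ.⊖-≤ m≤n) ⟩
      ⟦ ℤ.- (+ (n ∸ m)) ⟧ℤ     ≈⟨ ⟦-+n⟧ (n ∸ m) ⟩
      - ι (n ∸ m)              ≈⟨ -‿cong (ι-∸ m≤n) ⟩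
      - (ι n - ι m)            ≈⟨ ⁻¹-anti-homo‿- (ι n) (ι m) ⟩
      ι m - ι n                ∎

    +-homo : ∀ i j → ⟦ i ℤ.+ j ⟧ℤ ≈ ⟦ i ⟧ℤ + ⟦ j ⟧ℤ
    +-homo (+ m)    (+ n)    = ι-+ m n
    +-homo (+ m)    -[1+ n ] = ⊖-homo m (suc n)
    +-homo -[1+ m ] (+ n)    = trans (⊖-homo n (suc m)) (+-comm _ _)
    +-homo -[1+ m ] -[1+ n ] = begin
      - ι (suc (suc (m ℕ.+ n)))     ≈⟨ -‿cong (ι-cong (≡.cong suc (≡.sym (ℕₚ.+-suc m n)))) ⟩
      - ι (suc m ℕ.+ suc n)         ≈⟨ -‿cong (ι-+ (suc m) (suc n)) ⟩
      - (ι (suc m) + ι (suc n))     ≈⟨ sym (-‿+-comm _ _) ⟩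
      - ι (suc m) + - ι (suc n)     ∎

    -- multiplication is handled through the decomposition i = sign i · ∣ i ∣
    ⟦_⟧ₛ : Sign → Carrier
    ⟦ Sign.+ ⟧ₛ = 1#
    ⟦ Sign.- ⟧ₛ = - 1#

    ◃-homo : ∀ s n → ⟦ s ◃ n ⟧ℤ ≈ ⟦ s ⟧ₛ * ι n
    ◃-homo s        zero    = sym (zeroʳ _)
    ◃-homo Sign.+   (suc n) = sym (*-identityˡ _)
    ◃-homo Sign.-   (suc n) = trans (-‿cong (sym (*-identityˡ _))) (-‿distribˡ-* _ _)

    sign-abs : ∀ i → ⟦ i ⟧ℤ ≈ ⟦ sign i ⟧ₛ * ι ∣ i ∣
    sign-abs (+ n)    = sym (*-identityˡ _)
    sign-abs -[1+ n ] = ◃-homo Sign.- (suc n)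

    sign-homo : ∀ s t → ⟦ s Sign.* t ⟧ₛ ≈ ⟦ s ⟧ₛ * ⟦ t ⟧ₛ
    sign-homo Sign.+ t      = sym (*-identityˡ _)
    sign-homo Sign.- Sign.+ = sym (*-identityʳ _)
    sign-homo Sign.- Sign.- = begin
      1#                ≈⟨ sym (-‿involutive 1#) ⟩
      - (- 1#)          ≈⟨ -‿cong (sym (*-identityˡ _)) ⟩
      - (1# * - 1#)     ≈⟨ -‿distribˡ-* _ _ ⟩
      - 1# * - 1#       ∎

    *-homo : ∀ i j → ⟦ i ℤ.* j ⟧ℤ ≈ ⟦ i ⟧ℤ * ⟦ j ⟧ℤ
    *-homo i j = begin
      ⟦ (sign i Sign.* sign j) ◃ (∣ i ∣ ℕ.* ∣ j ∣) ⟧ℤ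
        ≈⟨ ◃-homo (sign i Sign.* sign j) (∣ i ∣ ℕ.* ∣ j ∣) ⟩
      ⟦ sign i Sign.* sign j ⟧ₛ * ι (∣ i ∣ ℕ.* ∣ j ∣)
        ≈⟨ *-cong (sign-homo (sign i) (sign j)) (×1-homo-* ∣ i ∣ ∣ j ∣) ⟩
      (⟦ sign i ⟧ₛ * ⟦ sign j ⟧ₛ) * (ι ∣ i ∣ * ι ∣ j ∣)
        ≈⟨ *-interchange _ _ _ _ ⟩
      (⟦ sign i ⟧ₛ * ι ∣ i ∣) * (⟦ sign j ⟧ₛ * ι ∣ j ∣)
        ≈⟨ sym (*-cong (sign-abs i) (sign-abs j)) ⟩
      ⟦ i ⟧ℤ * ⟦ j ⟧ℤ ∎

    -‿homo : ∀ i → ⟦ ℤ.- i ⟧ℤ ≈ - ⟦ i ⟧ℤ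
    -‿homo (+ n)    = ⟦-+n⟧ n
    -‿homo -[1+ n ] = sym (-‿involutive _)

    ℤ-rawRing : RawRing _ _
    ℤ-rawRing = record
      { Carrier = ℤ ; _≈_ = _≡_ ; _+_ = ℤ._+_ ; _*_ = ℤ._*_ ; -_ = ℤ.-_ ; 0# = + 0 ; 1# = + 1 }

    ℤ⟶R : ℤ-rawRing ACR.-Raw-AlmostCommutative⟶ ACR.fromCommutativeRing R
    ℤ⟶R = record
      { ⟦_⟧ = ⟦_⟧ℤ ; +-homo = +-homo ; *-homo = *-homo ; -‿homo = -‿homo
      ; 0-homo = refl ; 1-homo = refl }

    ℤ-test : ∀ i j → Maybe (⟦ i ⟧ℤ ≈ ⟦ j ⟧ℤ)
    ℤ-test i j with i ℤ.≟ j
    ... | yes ≡.refl = just refl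
    ... | no _       = nothing

  open RingSolver ℤ-rawRing (ACR.fromCommutativeRing R) ℤ⟶R ℤ-test public

module FieldFacts {c ℓ} (F : Field c ℓ) where
  open Field F
  open FieldOps F using (_·_; _^_)
  open IntegerSolver commutativeRing
  open import Relation.Binary.Reasoning.Setoid setoid

  ·≈ι* : ∀ k y → k · y ≈ ι k * y
  ·≈ι* zero    y = sym (zeroˡ y)
  ·≈ι* (suc k) y = begin
    y + k · y             ≈⟨ +-cong (sym (*-identityˡ y)) (·≈ι* k y) ⟩
    1# * y + ι k * y      ≈⟨ sym (distribʳ y 1# (ι k)) ⟩
    (1# + ι k) * y        ≈⟨ *-congʳ (sym (ι-suc k)) ⟩
    ι (suc k) * y         ∎

  cancelˡ : ∀ {x y} → ¬ (x ≈ 0#) → x * y ≈ 0# → y ≈ 0#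
  cancelˡ {x} {y} x≉0 xy≈0 with inverse x x≉0
  ... | x⁻¹ , xx⁻¹≈1 = begin
    y                ≈⟨ sym (*-identityˡ y) ⟩
    1# * y           ≈⟨ *-congʳ (sym xx⁻¹≈1) ⟩
    (x * x⁻¹) * y    ≈⟨ solve 3 (λ x x⁻¹ y → (x :* x⁻¹) :* y := x⁻¹ :* (x :* y)) refl x x⁻¹ y ⟩
    x⁻¹ * (x * y)    ≈⟨ *-congˡ xy≈0 ⟩
    x⁻¹ * 0#         ≈⟨ zeroʳ x⁻¹ ⟩
    0#               ∎

  *-nonzero : ∀ {x y} → ¬ (x ≈ 0#) → ¬ (y ≈ 0#) → ¬ (x * y ≈ 0#)
  *-nonzero x≉0 y≉0 xy≈0 = y≉0 (cancelˡ x≉0 xy≈0)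

  x-y≈0⇒x≈y : ∀ {x y} → x - y ≈ 0# → x ≈ y
  x-y≈0⇒x≈y {x} {y} x-y≈0 = begin
    x             ≈⟨ solve 2 (λ x y → x := (x :- y) :+ y) refl x y ⟩
    (x - y) + y   ≈⟨ +-congʳ x-y≈0 ⟩
    0# + y        ≈⟨ +-identityˡ y ⟩
    y             ∎

  x≈y⇒x-y≈0 : ∀ {x y} → x ≈ y → x - y ≈ 0#
  x≈y⇒x-y≈0 {x} {y} x≈y = trans (+-congʳ x≈y) (-‿inverseʳ y)

  inverse-unique : ∀ {x y z} → x * y ≈ 1# → x * z ≈ 1# → y ≈ z
  inverse-unique {x} {y} {z} xy≈1 xz≈1 = begin
    y              ≈⟨ sym (*-identityʳ y) ⟩
    y * 1#         ≈⟨ *-congˡ (sym xz≈1) ⟩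
    y * (x * z)    ≈⟨ solve 3 (λ x y z → y :* (x :* z) := (x :* y) :* z) refl x y z ⟩
    (x * y) * z    ≈⟨ *-congʳ xy≈1 ⟩
    1# * z         ≈⟨ *-identityˡ z ⟩
    z              ∎

  ^-cong : ∀ {x y} k → x ≈ y → x ^ k ≈ y ^ k
  ^-cong zero    x≈y = refl
  ^-cong (suc k) x≈y = *-cong x≈y (^-cong k x≈y)

  ^-distrib-* : ∀ x y k → (x * y) ^ k ≈ x ^ k * y ^ k
  ^-distrib-* x y zero    = sym (*-identityʳ 1#)
  ^-distrib-* x y (suc k) = begin
    (x * y) * (x * y) ^ k         ≈⟨ *-congˡ (^-distrib-* x y k) ⟩
    (x * y) * (x ^ k * y ^ k)     ≈⟨ solve 4 (λ x y p q → (x :* y) :* (p :* q) := (x :* p) :* (y :* q)) refl x y (x ^ k) (y ^ k) ⟩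
    (x * x ^ k) * (y * y ^ k)     ∎

  1^k≈1 : ∀ k → 1# ^ k ≈ 1#
  1^k≈1 zero    = refl
  1^k≈1 (suc k) = trans (*-identityˡ _) (1^k≈1 k)

-- Division by x - r (Horner's scheme) then shows that a
-- polynomial vanishing at r has the factor x - r, which is what makes a
-- root that is met twice a root of the derivative.
module Polynomials {c ℓ} (F : Field c ℓ) where
  open Field F
  open FieldOps F
  open IntegerSolver commutativeRing
  open FieldFacts F
  open import Relation.Binary.Reasoning.Setoid setoid

  _≋_ : Poly → Poly → Set (c ⊔ ℓ)
  _≋_ = Pointwise _≈_

  eval′ : Poly → Carrier → Carrier
  eval′ p x = eval (deriv p) x

  eval-cong : ∀ {p q} → p ≋ q → ∀ x → eval p x ≈ eval q x
  eval-cong []           x = refl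
  eval-cong (a≈b ∷ p≋q) x = +-cong a≈b (*-congˡ (eval-cong p≋q x))

  derivFrom-suc : ∀ k p x → eval (derivFrom (suc k) p) x ≈ eval (derivFrom k p) x + eval p x
  derivFrom-suc k []      x = sym (+-identityʳ _)
  derivFrom-suc k (a ∷ p) x = begin
    suc k · a + x * eval (derivFrom (suc (suc k)) p) x
      ≈⟨ +-cong (trans (·≈ι* (suc k) a) (*-congʳ (ι-suc k))) (*-congˡ (derivFrom-suc (suc k) p x)) ⟩
    (1# + ι k) * a + x * (eval (derivFrom (suc k) p) x + eval p x)
      ≈⟨ solve 5 (λ i a x d e → (con (+ 1) :+ i) :* a :+ x :* (d :+ e) := (i :* a :+ x :* d) :+ (a :+ x :* e))
           refl (ι k) a x (eval (derivFrom (suc k) p) x) (eval p x) ⟩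
    (ι k * a + x * eval (derivFrom (suc k) p) x) + (a + x * eval p x)
      ≈⟨ +-congʳ (+-congʳ (sym (·≈ι* k a))) ⟩
    (k · a + x * eval (derivFrom (suc k) p) x) + (a + x * eval p x) ∎

  deriv-∷ : ∀ a p x → eval′ (a ∷ p) x ≈ eval p x + x * eval′ p x
  deriv-∷ a []      x = sym (trans (+-identityˡ _) (zeroʳ x))
  deriv-∷ a (b ∷ p) x = begin
    eval (derivFrom 1 (b ∷ p)) x                  ≈⟨ derivFrom-suc 0 (b ∷ p) x ⟩
    eval (derivFrom 0 (b ∷ p)) x + eval (b ∷ p) x ≈⟨ +-comm _ _ ⟩
    eval (b ∷ p) x + (0 · b + x * eval′ (b ∷ p) x) ≈⟨ +-congˡ (+-identityˡ _) ⟩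
    eval (b ∷ p) x + x * eval′ (b ∷ p) x          ∎

  deriv-cong : ∀ {p q} → p ≋ q → ∀ x → eval′ p x ≈ eval′ q x
  deriv-cong []                   x = refl
  deriv-cong {a ∷ p} {b ∷ q} (a≈b ∷ p≋q) x = begin
    eval′ (a ∷ p) x              ≈⟨ deriv-∷ a p x ⟩
    eval p x + x * eval′ p x     ≈⟨ +-cong (eval-cong p≋q x) (*-congˡ (deriv-cong p≋q x)) ⟩
    eval q x + x * eval′ q x     ≈⟨ sym (deriv-∷ b q x) ⟩
    eval′ (b ∷ q) x              ∎

  eval-⊕ : ∀ p q x → eval (p ⊕ q) x ≈ eval p x + eval q x
  eval-⊕ []      q       x = sym (+-identityˡ _)
  eval-⊕ (a ∷ p) []      x = sym (+-identityʳ _)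
  eval-⊕ (a ∷ p) (b ∷ q) x = begin
    (a + b) + x * eval (p ⊕ q) x           ≈⟨ +-congˡ (*-congˡ (eval-⊕ p q x)) ⟩
    (a + b) + x * (eval p x + eval q x)    ≈⟨ solve 5 (λ a b x p q → (a :+ b) :+ x :* (p :+ q) := (a :+ x :* p) :+ (b :+ x :* q)) refl a b x (eval p x) (eval q x) ⟩
    (a + x * eval p x) + (b + x * eval q x) ∎

  deriv-⊕ : ∀ p q x → eval′ (p ⊕ q) x ≈ eval′ p x + eval′ q x
  deriv-⊕ []      q       x = sym (+-identityˡ _)
  deriv-⊕ (a ∷ p) []      x = sym (+-identityʳ _)
  deriv-⊕ (a ∷ p) (b ∷ q) x = begin
    eval′ ((a + b) ∷ (p ⊕ q)) x                      ≈⟨ deriv-∷ (a + b) (p ⊕ q) x ⟩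
    eval (p ⊕ q) x + x * eval′ (p ⊕ q) x             ≈⟨ +-cong (eval-⊕ p q x) (*-congˡ (deriv-⊕ p q x)) ⟩
    (eval p x + eval q x) + x * (eval′ p x + eval′ q x)
      ≈⟨ solve 5 (λ x p q p′ q′ → (p :+ q) :+ x :* (p′ :+ q′) := (p :+ x :* p′) :+ (q :+ x :* q′)) refl x (eval p x) (eval q x) (eval′ p x) (eval′ q x) ⟩
    (eval p x + x * eval′ p x) + (eval q x + x * eval′ q x) ≈⟨ sym (+-cong (deriv-∷ a p x) (deriv-∷ b q x)) ⟩
    eval′ (a ∷ p) x + eval′ (b ∷ q) x                ∎

  eval-monomial : ∀ k a x → eval (monomial k a) x ≈ x ^ k * a
  eval-monomial zero    a x = begin
    a + x * 0#    ≈⟨ +-congˡ (zeroʳ x) ⟩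
    a + 0#        ≈⟨ +-identityʳ a ⟩
    a             ≈⟨ sym (*-identityˡ a) ⟩
    1# * a        ∎
  eval-monomial (suc k) a x = begin
    0# + x * eval (monomial k a) x   ≈⟨ +-identityˡ _ ⟩
    x * eval (monomial k a) x        ≈⟨ *-congˡ (eval-monomial k a x) ⟩
    x * (x ^ k * a)                  ≈⟨ sym (*-assoc x (x ^ k) a) ⟩
    (x * x ^ k) * a                  ∎

  dpow : Carrier → ℕ → Carrier
  dpow x zero    = 0#
  dpow x (suc k) = ι (suc k) * x ^ k

  dpow-suc : ∀ x k → dpow x (suc k) ≈ x ^ k + x * dpow x k
  dpow-suc x zero    = begin
    ι 1 * 1#          ≈⟨ *-identityʳ _ ⟩
    1#                ≈⟨ sym (+-identityʳ 1#) ⟩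
    1# + 0#           ≈⟨ +-congˡ (sym (zeroʳ x)) ⟩
    1# + x * 0#       ∎
  dpow-suc x (suc k) = begin
    ι (suc (suc k)) * (x * x ^ k)     ≈⟨ *-congʳ (ι-suc (suc k)) ⟩
    (1# + ι (suc k)) * (x * x ^ k)
      ≈⟨ solve 3 (λ i x p → (con (+ 1) :+ i) :* (x :* p) := x :* p :+ x :* (i :* p)) refl (ι (suc k)) x (x ^ k) ⟩
    x * x ^ k + x * (ι (suc k) * x ^ k) ∎

  deriv-monomial : ∀ k a x → eval′ (monomial k a) x ≈ dpow x k * a
  deriv-monomial zero    a x = begin
    eval′ [ a ] x        ≈⟨ deriv-∷ a [] x ⟩
    0# + x * 0#          ≈⟨ trans (+-identityˡ _) (zeroʳ x) ⟩
    0#                   ≈⟨ sym (zeroˡ a) ⟩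
    0# * a               ∎
  deriv-monomial (suc k) a x = begin
    eval′ (0# ∷ monomial k a) x                              ≈⟨ deriv-∷ 0# (monomial k a) x ⟩
    eval (monomial k a) x + x * eval′ (monomial k a) x       ≈⟨ +-cong (eval-monomial k a x) (*-congˡ (deriv-monomial k a x)) ⟩
    x ^ k * a + x * (dpow x k * a)
      ≈⟨ solve 4 (λ p a x d → p :* a :+ x :* (d :* a) := (p :+ x :* d) :* a) refl (x ^ k) a x (dpow x k) ⟩
    (x ^ k + x * dpow x k) * a                               ≈⟨ *-congʳ (sym (dpow-suc x k)) ⟩
    dpow x (suc k) * a                                       ∎

  divide : Carrier → Poly → Poly
  divide r []          = []
  divide r (a ∷ [])    = []
  divide r (a ∷ b ∷ p) = eval (b ∷ p) r ∷ divide r (b ∷ p)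

  divide-eval : ∀ r p x → eval p x ≈ (x - r) * eval (divide r p) x + eval p r
  divide-eval r []          x = sym (trans (+-identityʳ _) (zeroʳ _))
  divide-eval r (a ∷ [])    x = solve 3 (λ a x r → a :+ x :* con (+ 0) := (x :- r) :* con (+ 0) :+ (a :+ r :* con (+ 0))) refl a x r
  divide-eval r (a ∷ b ∷ p) x = begin
    a + x * eval (b ∷ p) x                ≈⟨ +-congˡ (*-congˡ (divide-eval r (b ∷ p) x)) ⟩
    a + x * ((x - r) * q + v)
      ≈⟨ solve 5 (λ a x r q v → a :+ x :* ((x :- r) :* q :+ v) := (x :- r) :* (v :+ x :* q) :+ (a :+ r :* v)) refl a x r q v ⟩
    (x - r) * (v + x * q) + (a + r * v)   ∎
    where
      q v : Carrier
      q = eval (divide r (b ∷ p)) x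
      v = eval (b ∷ p) r

  divide-deriv : ∀ r p x → eval′ p x ≈ eval (divide r p) x + (x - r) * eval′ (divide r p) x
  divide-deriv r []          x = sym (trans (+-identityˡ _) (zeroʳ _))
  divide-deriv r (a ∷ [])    x = trans (deriv-∷ a [] x) (+-congˡ (trans (zeroʳ x) (sym (zeroʳ _))))
  divide-deriv r (a ∷ b ∷ p) x = begin
    eval′ (a ∷ b ∷ p) x                              ≈⟨ deriv-∷ a (b ∷ p) x ⟩
    eval (b ∷ p) x + x * eval′ (b ∷ p) x             ≈⟨ +-cong (divide-eval r (b ∷ p) x) (*-congˡ (divide-deriv r (b ∷ p) x)) ⟩
    ((x - r) * q + v) + x * (q + (x - r) * q′)
      ≈⟨ solve 5 (λ x r q q′ v → ((x :- r) :* q :+ v) :+ x :* (q :+ (x :- r) :* q′) := (v :+ x :* q) :+ (x :- r) :* (q :+ x :* q′)) refl x r q q′ v ⟩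
    (v + x * q) + (x - r) * (q + x * q′)             ≈⟨ +-congˡ (*-congˡ (sym (deriv-∷ v (divide r (b ∷ p)) x))) ⟩
    (v + x * q) + (x - r) * eval′ (v ∷ divide r (b ∷ p)) x ∎
    where
      q q′ v : Carrier
      q  = eval (divide r (b ∷ p)) x
      q′ = eval′ (divide r (b ∷ p)) x
      v  = eval (b ∷ p) r

  HasDegree : ℕ → Poly → Set ℓ
  HasDegree d       []          = Lift ℓ ⊥
  HasDegree zero    (a ∷ [])    = ¬ (a ≈ 0#)
  HasDegree zero    (a ∷ _ ∷ _) = Lift ℓ ⊥
  HasDegree (suc d) (a ∷ p)     = HasDegree d p

  divide-degree : ∀ r d p → HasDegree (suc d) p → HasDegree d (divide r p)
  divide-degree r zero    (a ∷ b ∷ [])    b≉0 v≈0 = b≉0 (trans (sym (trans (+-congˡ (zeroʳ r)) (+-identityʳ b))) v≈0)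
  divide-degree r (suc d) (a ∷ b ∷ p)     deg = divide-degree r d (b ∷ p) deg
  divide-degree r zero    (a ∷ b ∷ _ ∷ _) (lift ())
  divide-degree r d       (a ∷ [])        (lift ())
  divide-degree r d       []              (lift ())

  nonconstant : ∀ d p → HasDegree (suc d) p → ¬ IsConstant p
  nonconstant d (a ∷ p) deg = leading-nonzero d p deg
    where
      leading-nonzero : ∀ d p → HasDegree d p → ¬ All (_≈ 0#) p
      leading-nonzero zero    (b ∷ [])    b≉0 (b≈0 ∷ []) = b≉0 b≈0
      leading-nonzero (suc d) (b ∷ p)     deg (_ ∷ p≈0)  = leading-nonzero d p deg p≈0

  divide-root : ∀ {σ τ} p → eval p σ ≈ 0# → ¬ (σ ≈ τ) → eval p τ ≈ 0# → eval (divide σ p) τ ≈ 0#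
  divide-root {σ} {τ} p pσ≈0 σ≉τ pτ≈0 = cancelˡ (λ τ-σ≈0 → σ≉τ (sym (x-y≈0⇒x≈y τ-σ≈0))) (begin
    (τ - σ) * eval (divide σ p) τ              ≈⟨ sym (+-identityʳ _) ⟩
    (τ - σ) * eval (divide σ p) τ + 0#         ≈⟨ +-congˡ (sym pσ≈0) ⟩
    (τ - σ) * eval (divide σ p) τ + eval p σ   ≈⟨ sym (divide-eval σ p τ) ⟩
    eval p τ                                   ≈⟨ pτ≈0 ⟩
    0#                                         ∎)

  -- a root r of the quotient q = p / (x - σ) is a root of p, and a root of
  -- p′ = q + (x - σ)·q′ as soon as r = σ or r is a root of q′
  lift-root : ∀ σ S p → eval p σ ≈ 0# →
              (∃ λ r → eval (divide σ p) r ≈ 0# × (Any (r ≈_) S → eval′ (divide σ p) r ≈ 0#)) →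
              ∃ λ r → eval p r ≈ 0# × (Any (r ≈_) (σ ∷ S) → eval′ p r ≈ 0#)
  lift-root σ S p pσ≈0 (r , qr≈0 , multiple) = r , pr≈0 , p′r≈0
    where
      q : Poly
      q = divide σ p

      pr≈0 : eval p r ≈ 0#
      pr≈0 = begin
        eval p r                        ≈⟨ divide-eval σ p r ⟩
        (r - σ) * eval q r + eval p σ   ≈⟨ +-cong (*-congˡ qr≈0) pσ≈0 ⟩
        (r - σ) * 0# + 0#               ≈⟨ trans (+-identityʳ _) (zeroʳ _) ⟩
        0#                              ∎

      second-vanishes : Any (r ≈_) (σ ∷ S) → (r - σ) * eval′ q r ≈ 0#
      second-vanishes (here r≈σ)  = trans (*-congʳ (x≈y⇒x-y≈0 r≈σ)) (zeroˡ _)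
      second-vanishes (there r∈S) = trans (*-congˡ (multiple r∈S)) (zeroʳ _)

      p′r≈0 : Any (r ≈_) (σ ∷ S) → eval′ p r ≈ 0#
      p′r≈0 r∈σ∷S = begin
        eval′ p r                          ≈⟨ divide-deriv σ p r ⟩
        eval q r + (r - σ) * eval′ q r     ≈⟨ +-cong qr≈0 (second-vanishes r∈σ∷S) ⟩
        0# + 0#                            ≈⟨ +-identityʳ 0# ⟩
        0#                                 ∎

  -- A polynomial of degree k + d + 1 with k known distinct roots S has, in
  -- an algebraically closed field, a root which is new or a multiple root:
  -- divide out the known roots and take a root of the quotient.
  root-beyond : AlgebraicallyClosed → ∀ S d p → HasDegree (length S ℕ.+ suc d) p →
                All (λ σ → eval p σ ≈ 0#) S → AllPairs (λ σ τ → ¬ (σ ≈ τ)) S →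
                ∃ λ r → eval p r ≈ 0# × (Any (r ≈_) S → eval′ p r ≈ 0#)
  root-beyond closed [] d p deg [] [] =
    proj₁ root , proj₂ root , λ ()
    where
      root : ∃ λ r → eval p r ≈ 0#
      root = closed p (nonconstant d p deg)
  root-beyond closed (σ ∷ S) d p deg (pσ≈0 ∷ pS≈0) (σ∉S ∷ S-distinct) =
    lift-root σ S p pσ≈0
      (root-beyond closed S d (divide σ p) (divide-degree σ (length S ℕ.+ suc d) p deg)
                   (All.zipWith (λ (σ≉τ , pτ≈0) → divide-root p pσ≈0 σ≉τ pτ≈0) (σ∉S , pS≈0)) S-distinct)

  binomial : ℕ → Carrier → Poly
  binomial m c = (- c) ∷ monomial m 1#

  eval-binomial : ∀ m c x → eval (binomial m c) x ≈ x ^ suc m - c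
  eval-binomial m c x = begin
    - c + x * eval (monomial m 1#) x   ≈⟨ +-congˡ (*-congˡ (trans (eval-monomial m 1# x) (*-identityʳ _))) ⟩
    - c + x * x ^ m                    ≈⟨ +-comm _ _ ⟩
    x ^ suc m - c                      ∎

  deriv-binomial : ∀ m c x → eval′ (binomial m c) x ≈ ι (suc m) * x ^ m
  deriv-binomial m c x = begin
    eval′ (binomial m c) x                                   ≈⟨ deriv-∷ (- c) (monomial m 1#) x ⟩
    eval (monomial m 1#) x + x * eval′ (monomial m 1#) x     ≈⟨ sym (deriv-∷ 0# (monomial m 1#) x) ⟩
    eval′ (monomial (suc m) 1#) x                            ≈⟨ trans (deriv-monomial (suc m) 1# x) (*-identityʳ _) ⟩
    ι (suc m) * x ^ m                                        ∎

  binomial-degree : ∀ m c → HasDegree (suc m) (binomial m c)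
  binomial-degree m c = monomial-degree m
    where
      monomial-degree : ∀ m → HasDegree m (monomial m 1#)
      monomial-degree zero    1≈0 = 0≉1 (sym 1≈0)
      monomial-degree (suc m) = monomial-degree m

  -- In characteristic 0 the polynomial xᵐ⁺¹ - c with c ≠ 0 has no
  -- multiple root (its derivative only vanishes at 0), so an algebraically
  -- closed field contains a root outside any list of at most m roots.
  fresh-root : AlgebraicallyClosed → (∀ k → ¬ (ι (suc k) ≈ 0#)) →
               ∀ m c → ¬ (c ≈ 0#) → ∀ S → All (λ τ → τ ^ suc m ≈ c) S →
               AllPairs (λ σ τ → ¬ (σ ≈ τ)) S → length S ≤ m →
               ∃ λ r → r ^ suc m ≈ c × All (λ σ → ¬ (r ≈ σ)) S
  fresh-root closed char0 m c c≉0 S S-roots S-distinct |S|≤m = r , rᵐ⁺¹≈c , ¬Any⇒All¬ S r∉S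
    where
      d : ℕ
      d = proj₁ (ℕₚ.m≤n⇒∃[o]m+o≡n |S|≤m)

      degree : HasDegree (length S ℕ.+ suc d) (binomial m c)
      degree = ≡.subst (λ k → HasDegree k (binomial m c))
                       (≡.trans (≡.cong suc (≡.sym (proj₂ (ℕₚ.m≤n⇒∃[o]m+o≡n |S|≤m))))
                                (≡.sym (ℕₚ.+-suc (length S) d)))
                       (binomial-degree m c)

      is-root : ∀ {τ} → τ ^ suc m ≈ c → eval (binomial m c) τ ≈ 0#
      is-root τᵐ⁺¹≈c = trans (eval-binomial m c _) (x≈y⇒x-y≈0 τᵐ⁺¹≈c)

      found : ∃ λ r → eval (binomial m c) r ≈ 0# × (Any (r ≈_) S → eval′ (binomial m c) r ≈ 0#)
      found = root-beyond closed S d (binomial m c) degree (All.map is-root S-roots) S-distinct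

      r : Carrier
      r = proj₁ found

      rᵐ⁺¹≈c : r ^ suc m ≈ c
      rᵐ⁺¹≈c = x-y≈0⇒x≈y (trans (sym (eval-binomial m c r)) (proj₁ (proj₂ found)))

      r∉S : ¬ Any (r ≈_) S
      r∉S r∈S = c≉0 (begin
        c               ≈⟨ sym rᵐ⁺¹≈c ⟩
        r * r ^ m       ≈⟨ *-congˡ (cancelˡ (char0 m) (trans (sym (deriv-binomial m c r)) (proj₂ (proj₂ found) r∈S))) ⟩
        r * 0#          ≈⟨ zeroʳ r ⟩
        0#              ∎)

-- The combinatorial input on the coefficients e(n, j) of
-- Dₙ = Σⱼ e(n,j)·(-a)ʲ·xⁿ⁻²ʲ: the Dickson recurrence holds coefficientwise
-- from n = 3 on, and the first two polynomials are D₁ = x, D₂ = x² - 2a.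
record DicksonArray (e : ℕ → ℕ → ℕ) : Set where
  field
    leading   : ∀ m → e (suc m) 0 ≡ 1
    vanishing : ∀ n j → n < 2 ℕ.* j → e n j ≡ 0
    pascal    : ∀ m j → e (3 ℕ.+ m) (suc j) ≡ e (2 ℕ.+ m) (suc j) ℕ.+ e (1 ℕ.+ m) j
    middle    : e 2 1 ≡ 2

-- The
-- key identity is n/(n-j)·C(n-j, j) = C(n-j, j) + C(n-j-1, j-1), a
-- consequence of the absorption identity for binomial coefficients; the
-- recurrence then follows from Pascal's rule.  (The coefficients do not
-- depend on the field; it only serves to name them.)
module DicksonCoefficients {c ℓ} (F : Field c ℓ) where
  open FieldOps F using (dicksonCoeff)
  open import Data.Nat using (_+_; _*_; z<s)
  open import Data.Nat.DivMod using (_/_; m*n/n≡m)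
  open import Data.Nat.Combinatorics using (_C_; nCk+nC[k+1]≡[n+1]C[k+1]; k>n⇒nCk≡0; nC1≡n)
  open import Data.Nat.Solver using (module +-*-Solver)
  open ≡.≡-Reasoning

  pascal-C : ∀ n k → suc n C suc k ≡ n C k + n C suc k
  pascal-C n k = ≡.sym (nCk+nC[k+1]≡[n+1]C[k+1] n k)

  absorption : ∀ m k → suc k * (suc m C suc k) ≡ suc m * (m C k)
  absorption zero    zero    = ≡.refl
  absorption zero    (suc k) = begin
    suc (suc k) * (1 C suc (suc k))   ≡⟨ ≡.cong (suc (suc k) *_) (k>n⇒nCk≡0 {1} {suc (suc k)} (s≤s (s≤s z≤n))) ⟩
    suc (suc k) * 0                   ≡⟨ ℕₚ.*-zeroʳ (suc (suc k)) ⟩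
    0                                 ≡⟨ ≡.cong (1 *_) (k>n⇒nCk≡0 {0} {suc k} z<s) ⟨
    1 * (0 C suc k)                   ∎
  absorption (suc m) zero    = begin
    1 * (suc (suc m) C 1)   ≡⟨ ℕₚ.*-identityˡ _ ⟩
    suc (suc m) C 1         ≡⟨ nC1≡n (suc (suc m)) ⟩
    suc (suc m)             ≡⟨ ℕₚ.*-identityʳ _ ⟨
    suc (suc m) * 1         ∎
  absorption (suc m) (suc k) = begin
    suc (suc k) * (suc (suc m) C suc (suc k))           ≡⟨ ≡.cong (suc (suc k) *_) (pascal-C (suc m) (suc k)) ⟩
    suc (suc k) * (X + Y)                               ≡⟨ ℕₚ.*-distribˡ-+ (suc (suc k)) X Y ⟩
    (X + suc k * X) + suc (suc k) * Y                   ≡⟨ ≡.cong₂ (λ u v → (X + u) + v) (absorption m k) (absorption m (suc k)) ⟩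
    (X + suc m * (m C k)) + suc m * (m C suc k)         ≡⟨ ℕₚ.+-assoc X _ _ ⟩
    X + (suc m * (m C k) + suc m * (m C suc k))         ≡⟨ ≡.cong (λ u → X + u) (ℕₚ.*-distribˡ-+ (suc m) (m C k) (m C suc k)) ⟨
    X + suc m * (m C k + m C suc k)                     ≡⟨ ≡.cong (λ u → X + suc m * u) (pascal-C m k) ⟨
    suc (suc m) * X                                     ∎
    where
      X Y : ℕ
      X = suc m C suc k
      Y = suc m C suc (suc k)

  C-pred : ℕ → ℕ → ℕ
  C-pred r zero    = 0
  C-pred r (suc j) = r C j

  j*C≡[1+r]*C-pred : ∀ r j → j * (suc r C j) ≡ suc r * C-pred r j
  j*C≡[1+r]*C-pred r zero    = ≡.sym (ℕₚ.*-zeroʳ (suc r))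
  j*C≡[1+r]*C-pred r (suc j) = absorption r j

  pascal-pred : ∀ r j → suc r C j ≡ C-pred r j + r C j
  pascal-pred r zero    = ≡.refl
  pascal-pred r (suc j) = pascal-C r j

  coeff-def : ∀ n j m → n ∸ j ≡ suc m → dicksonCoeff n j ≡ (n * (suc m C j)) / suc m
  coeff-def n j m eq with n ∸ j
  coeff-def n j m ≡.refl | .(suc m) = ≡.refl

  coeff-zero : ∀ {n j} → n ≤ j → dicksonCoeff n j ≡ 0
  coeff-zero {n} {j} n≤j with n ∸ j | ℕₚ.m≤n⇒m∸n≡0 n≤j
  ... | .0 | ≡.refl = ≡.refl

  -- n/(n-j)·C(n-j, j) = C(n-j, j) + C(n-j-1, j-1), written with n - j = r + 1
  coeff-closed : ∀ r j → dicksonCoeff (j + suc r) j ≡ suc r C j + C-pred r j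
  coeff-closed r j = begin
    dicksonCoeff (j + suc r) j           ≡⟨ coeff-def (j + suc r) j r (ℕₚ.m+n∸m≡n j (suc r)) ⟩
    ((j + suc r) * B) / suc r            ≡⟨ ≡.cong (_/ suc r) numerator ⟩
    ((B + C-pred r j) * suc r) / suc r   ≡⟨ m*n/n≡m (B + C-pred r j) (suc r) ⟩
    B + C-pred r j                       ∎
    where
      B : ℕ
      B = suc r C j
      numerator : (j + suc r) * B ≡ (B + C-pred r j) * suc r
      numerator = begin
        (j + suc r) * B                      ≡⟨ ℕₚ.*-distribʳ-+ B j (suc r) ⟩
        j * B + suc r * B                    ≡⟨ ≡.cong (_+ suc r * B) (j*C≡[1+r]*C-pred r j) ⟩
        suc r * C-pred r j + suc r * B       ≡⟨ ℕₚ.+-comm (suc r * C-pred r j) _ ⟩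
        suc r * B + suc r * C-pred r j       ≡⟨ ℕₚ.*-distribˡ-+ (suc r) B (C-pred r j) ⟨
        suc r * (B + C-pred r j)             ≡⟨ ℕₚ.*-comm (suc r) _ ⟩
        (B + C-pred r j) * suc r             ∎

  coeff-closed′ : ∀ {n} r j → n ≡ j + suc r → dicksonCoeff n j ≡ suc r C j + C-pred r j
  coeff-closed′ r j ≡.refl = coeff-closed r j

  coeff-vanishing : ∀ n j → n < 2 * j → dicksonCoeff n j ≡ 0
  coeff-vanishing n j n<2j with ℕₚ.≤-total n j
  ... | inj₁ n≤j = coeff-zero n≤j
  ... | inj₂ j≤n with ℕₚ.m≤n⇒∃[o]m+o≡n j≤n
  ...   | zero  , j+0≡n  = coeff-zero (ℕₚ.≤-reflexive (≡.trans (≡.sym j+0≡n) (ℕₚ.+-identityʳ j)))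
  ...   | suc r , ≡.refl = begin
    dicksonCoeff (j + suc r) j     ≡⟨ coeff-closed r j ⟩
    suc r C j + C-pred r j         ≡⟨ ≡.cong₂ _+_ (k>n⇒nCk≡0 1+r<j) (C-pred-vanishing j 1+r<j) ⟩
    0                              ∎
    where
      1+r<j : suc r < j
      1+r<j = ℕₚ.+-cancelˡ-< j (suc r) j (≡.subst (λ k → j + suc r < j + k) (ℕₚ.+-identityʳ j) n<2j)
      C-pred-vanishing : ∀ j → suc r < j → C-pred r j ≡ 0
      C-pred-vanishing (suc j) (s≤s r<j) = k>n⇒nCk≡0 r<j

  -- e(n+3, j+1) = e(n+2, j+1) + e(n+1, j): vanishing terms when j > m,
  -- and otherwise the closed form together with Pascal's rule
  coeff-pascal : ∀ m j → dicksonCoeff (3 + m) (suc j) ≡ dicksonCoeff (2 + m) (suc j) + dicksonCoeff (1 + m) j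
  coeff-pascal m j with j ℕₚ.≤? m
  ... | no j≰m = begin
    dicksonCoeff (3 + m) (suc j)      ≡⟨ coeff-vanishing (3 + m) (suc j) 3+m<2+2j ⟩
    0                                 ≡⟨ ≡.cong₂ _+_ (coeff-zero (s≤s m<j)) (coeff-zero m<j) ⟨
    dicksonCoeff (2 + m) (suc j) + dicksonCoeff (1 + m) j ∎
    where
      m<j : suc m ≤ j
      m<j = ℕₚ.≰⇒> j≰m
      3+m<2+2j : 3 + m < 2 * suc j
      3+m<2+2j = ℕₚ.≤-trans (s≤s (s≤s (s≤s m<j)))
        (≡.subst (3 + j ≤_) (≡.sym (ℕₚ.*-suc 2 j))
          (s≤s (s≤s (ℕₚ.+-mono-≤ (ℕₚ.≤-trans (s≤s z≤n) m<j) (ℕₚ.m≤m+n j 0)))))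
  ... | yes j≤m with ℕₚ.m≤n⇒∃[o]m+o≡n j≤m
  ...   | r , ≡.refl = begin
    dicksonCoeff (3 + (j + r)) (suc j)
      ≡⟨ coeff-closed′ (suc r) (suc j) (solve 2 (λ j r → con 3 :+ (j :+ r) := (con 1 :+ j) :+ (con 2 :+ r)) ≡.refl j r) ⟩
    suc (suc r) C suc j + suc r C j
      ≡⟨ ≡.cong₂ _+_ (pascal-C (suc r) j) (pascal-pred r j) ⟩
    (suc r C j + suc r C suc j) + (C-pred r j + r C j)
      ≡⟨ solve 4 (λ a b c p → (c :+ a) :+ (p :+ b) := (a :+ b) :+ (c :+ p)) ≡.refl (suc r C suc j) (r C j) (suc r C j) (C-pred r j) ⟩
    (suc r C suc j + r C j) + (suc r C j + C-pred r j)
      ≡⟨ ≡.cong₂ _+_ (coeff-closed′ r (suc j) (≡.cong suc (≡.sym (ℕₚ.+-suc j r)))) (coeff-closed′ r j (≡.sym (ℕₚ.+-suc j r))) ⟨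
    dicksonCoeff (2 + (j + r)) (suc j) + dicksonCoeff (1 + (j + r)) j ∎
    where open +-*-Solver

  dicksonArray : DicksonArray dicksonCoeff
  dicksonArray = record
    { leading   = λ m → coeff-closed m 0
    ; vanishing = coeff-vanishing
    ; pascal    = coeff-pascal
    ; middle    = ≡.refl
    }

-- Dickson sums in a field F: for a family g (standing for the powers xᵏ or
-- their derivatives) let Dₙ[g] = Σⱼ g(n - 2j)·e(n,j)·(-A)ʲ.  If g satisfies
-- g(k+1) = h(k) + x·g(k), the Dickson recurrence of the array e yields
-- D_{m+3}[g] = D_{m+2}[h] + x·D_{m+2}[g] - A·D_{m+1}[g].  Solving this
-- recurrence at x = u + v with u·v = A gives the functional equation
-- Dₙ(u + v) = uⁿ + vⁿ and its derivative (u - v)·Dₙ′(u + v) = n(uⁿ - vⁿ).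
module DicksonSums {c ℓ} (F : Field c ℓ) {e : ℕ → ℕ → ℕ} (array : DicksonArray e)
                   (A : Field.Carrier F) where
  open Field F
  open FieldOps F using (_^_)
  open IntegerSolver commutativeRing
  open FieldFacts F
  open Polynomials F using (dpow; dpow-suc)
  open DicksonArray array
  open import Relation.Binary.Reasoning.Setoid setoid

  Σ< : ℕ → (ℕ → Carrier) → Carrier
  Σ< zero    g = 0#
  Σ< (suc B) g = g 0 + Σ< B (λ j → g (suc j))

  Σ<-cong : ∀ B {g h} → (∀ j → g j ≈ h j) → Σ< B g ≈ Σ< B h
  Σ<-cong zero    g≈h = refl
  Σ<-cong (suc B) g≈h = +-cong (g≈h 0) (Σ<-cong B (λ j → g≈h (suc j)))

  Σ<-+ : ∀ B g h → Σ< B (λ j → g j + h j) ≈ Σ< B g + Σ< B h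
  Σ<-+ zero    g h = sym (+-identityʳ 0#)
  Σ<-+ (suc B) g h = begin
    (g 0 + h 0) + Σ< B (λ j → g (suc j) + h (suc j))   ≈⟨ +-congˡ (Σ<-+ B _ _) ⟩
    (g 0 + h 0) + (Σ< B (λ j → g (suc j)) + Σ< B (λ j → h (suc j)))
      ≈⟨ solve 4 (λ a b s t → (a :+ b) :+ (s :+ t) := (a :+ s) :+ (b :+ t)) refl (g 0) (h 0) _ _ ⟩
    (g 0 + Σ< B (λ j → g (suc j))) + (h 0 + Σ< B (λ j → h (suc j))) ∎

  Σ<-* : ∀ B y g → Σ< B (λ j → y * g j) ≈ y * Σ< B g
  Σ<-* zero    y g = sym (zeroʳ y)
  Σ<-* (suc B) y g = trans (+-congˡ (Σ<-* B y _)) (sym (distribˡ y _ _))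

  Σ<-zero : ∀ B g → (∀ j → g j ≈ 0#) → Σ< B g ≈ 0#
  Σ<-zero zero    g g≈0 = refl
  Σ<-zero (suc B) g g≈0 = trans (+-cong (g≈0 0) (Σ<-zero B _ (λ j → g≈0 (suc j)))) (+-identityʳ 0#)

  Σ<-drop-last : ∀ B g → g B ≈ 0# → Σ< (suc B) g ≈ Σ< B g
  Σ<-drop-last zero    g gB≈0 = trans (+-identityʳ _) gB≈0
  Σ<-drop-last (suc B) g gB≈0 = +-congˡ (Σ<-drop-last B (λ j → g (suc j)) gB≈0)

  Σ<-truncate : ∀ B k g → (∀ j → B ≤ j → g j ≈ 0#) → Σ< (B ℕ.+ k) g ≈ Σ< B g
  Σ<-truncate zero    k g g≈0 = Σ<-zero k g (λ j → g≈0 j z≤n)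
  Σ<-truncate (suc B) k g g≈0 = +-congˡ (Σ<-truncate B k (λ j → g (suc j)) (λ j B≤j → g≈0 (suc j) (s≤s B≤j)))

  coeff : ℕ → ℕ → Carrier
  coeff n j = ι (e n j) * (- A) ^ j

  term : (ℕ → Carrier) → ℕ → ℕ → Carrier
  term g n j = g (n ∸ 2 ℕ.* j) * coeff n j

  dsum : (ℕ → Carrier) → ℕ → Carrier
  dsum g n = Σ< (suc n) (term g n)

  coeff-vanishing : ∀ n j → n < 2 ℕ.* j → coeff n j ≈ 0#
  coeff-vanishing n j n<2j = trans (*-congʳ (ι-cong (vanishing n j n<2j))) (zeroˡ _)

  term-vanishing : ∀ g n j → n < 2 ℕ.* j → term g n j ≈ 0#
  term-vanishing g n j n<2j = trans (*-congˡ (coeff-vanishing n j n<2j)) (zeroʳ _)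

  term-leading : ∀ g m → term g (suc m) 0 ≈ g (suc m)
  term-leading g m = trans (*-congˡ (trans (*-congʳ (ι-cong (leading m))) (*-identityˡ _))) (*-identityʳ _)

  n<2[1+n] : ∀ n → n < 2 ℕ.* suc n
  n<2[1+n] n = ℕₚ.m≤m+n (suc n) _

  coeff-pascal : ∀ m j → coeff (3 ℕ.+ m) (suc j) ≈ coeff (2 ℕ.+ m) (suc j) + (- A) * coeff (1 ℕ.+ m) j
  coeff-pascal m j = begin
    ι (e (3 ℕ.+ m) (suc j)) * ((- A) * (- A) ^ j)           ≈⟨ *-congʳ (trans (ι-cong (pascal m j)) (ι-+ e₂ e₁)) ⟩
    (ι e₂ + ι e₁) * ((- A) * (- A) ^ j)
      ≈⟨ solve 4 (λ i₂ i₁ b p → (i₂ :+ i₁) :* (b :* p) := i₂ :* (b :* p) :+ b :* (i₁ :* p)) refl (ι e₂) (ι e₁) (- A) ((- A) ^ j) ⟩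
    ι e₂ * ((- A) * (- A) ^ j) + (- A) * (ι e₁ * (- A) ^ j) ∎
    where
      e₂ e₁ : ℕ
      e₂ = e (2 ℕ.+ m) (suc j)
      e₁ = e (1 ℕ.+ m) j

  module Recurrence {g h : ℕ → Carrier} {x : Carrier}
                    (g-suc : ∀ k → g (suc k) ≈ h k + x * g k) where

    g-cong : ∀ {k k′} → k ≡ k′ → g k ≈ g k′
    g-cong ≡.refl = refl

    h-cong : ∀ {k k′} → k ≡ k′ → h k ≈ h k′
    h-cong ≡.refl = refl

    shifted-term : ∀ m j → g ((1 ℕ.+ m) ∸ 2 ℕ.* j) * coeff (2 ℕ.+ m) (suc j) ≈
                           term h (2 ℕ.+ m) (suc j) + x * term g (2 ℕ.+ m) (suc j)
    shifted-term m j with 2 ℕ.* j ℕₚ.≤? m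
    ... | yes 2j≤m = begin
      g ((1 ℕ.+ m) ∸ 2 ℕ.* j) * d         ≈⟨ *-congʳ (trans (g-cong (ℕₚ.+-∸-assoc 1 2j≤m)) (g-suc k)) ⟩
      (h k + x * g k) * d                 ≈⟨ solve 4 (λ h x g c → (h :+ x :* g) :* c := h :* c :+ x :* (g :* c)) refl (h k) x (g k) d ⟩
      h k * d + x * (g k * d)             ≈⟨ sym (+-cong (*-congʳ (h-cong index)) (*-congˡ (*-congʳ (g-cong index)))) ⟩
      term h (2 ℕ.+ m) (suc j) + x * term g (2 ℕ.+ m) (suc j) ∎
      where
        k : ℕ
        k = m ∸ 2 ℕ.* j
        d : Carrier
        d = coeff (2 ℕ.+ m) (suc j)
        index : (2 ℕ.+ m) ∸ 2 ℕ.* suc j ≡ k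
        index = ≡.cong ((2 ℕ.+ m) ∸_) (ℕₚ.*-suc 2 j)
    ... | no 2j≰m = begin
      g ((1 ℕ.+ m) ∸ 2 ℕ.* j) * d          ≈⟨ *-congˡ d≈0 ⟩
      g ((1 ℕ.+ m) ∸ 2 ℕ.* j) * 0#         ≈⟨ zeroʳ _ ⟩
      0#                                   ≈⟨ solve 1 (λ x → con (+ 0) := con (+ 0) :+ x :* con (+ 0)) refl x ⟩
      0# + x * 0#                          ≈⟨ sym (+-cong (term-vanishing h (2 ℕ.+ m) (suc j) 2+m<2+2j) (*-congˡ (term-vanishing g (2 ℕ.+ m) (suc j) 2+m<2+2j))) ⟩
      term h (2 ℕ.+ m) (suc j) + x * term g (2 ℕ.+ m) (suc j) ∎
      where
        d : Carrier
        d = coeff (2 ℕ.+ m) (suc j)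
        2+m<2+2j : 2 ℕ.+ m < 2 ℕ.* suc j
        2+m<2+2j = ≡.subst (2 ℕ.+ m <_) (≡.sym (ℕₚ.*-suc 2 j)) (s≤s (s≤s (ℕₚ.≰⇒> 2j≰m)))
        d≈0 : d ≈ 0#
        d≈0 = coeff-vanishing (2 ℕ.+ m) (suc j) 2+m<2+2j

    term-recurrence : ∀ m j → term g (3 ℕ.+ m) (suc j) ≈
                      (term h (2 ℕ.+ m) (suc j) + x * term g (2 ℕ.+ m) (suc j)) + (- A) * term g (1 ℕ.+ m) j
    term-recurrence m j = begin
      g ((3 ℕ.+ m) ∸ 2 ℕ.* suc j) * coeff (3 ℕ.+ m) (suc j)
        ≈⟨ *-cong (g-cong (≡.cong ((3 ℕ.+ m) ∸_) (ℕₚ.*-suc 2 j))) (coeff-pascal m j) ⟩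
      G * (coeff (2 ℕ.+ m) (suc j) + (- A) * coeff (1 ℕ.+ m) j)
        ≈⟨ solve 4 (λ g c b d → g :* (c :+ b :* d) := g :* c :+ b :* (g :* d)) refl G (coeff (2 ℕ.+ m) (suc j)) (- A) (coeff (1 ℕ.+ m) j) ⟩
      G * coeff (2 ℕ.+ m) (suc j) + (- A) * term g (1 ℕ.+ m) j
        ≈⟨ +-congʳ (shifted-term m j) ⟩
      (term h (2 ℕ.+ m) (suc j) + x * term g (2 ℕ.+ m) (suc j)) + (- A) * term g (1 ℕ.+ m) j ∎
      where
        G : Carrier
        G = g ((1 ℕ.+ m) ∸ 2 ℕ.* j)

    leading-recurrence : ∀ m → term g (3 ℕ.+ m) 0 ≈ term h (2 ℕ.+ m) 0 + x * term g (2 ℕ.+ m) 0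
    leading-recurrence m = begin
      term g (3 ℕ.+ m) 0                        ≈⟨ term-leading g (2 ℕ.+ m) ⟩
      g (3 ℕ.+ m)                               ≈⟨ g-suc (2 ℕ.+ m) ⟩
      h (2 ℕ.+ m) + x * g (2 ℕ.+ m)             ≈⟨ sym (+-cong (term-leading h (1 ℕ.+ m)) (*-congˡ (term-leading g (1 ℕ.+ m)))) ⟩
      term h (2 ℕ.+ m) 0 + x * term g (2 ℕ.+ m) 0 ∎

    dsum-recurrence : ∀ m → dsum g (3 ℕ.+ m) ≈ (dsum h (2 ℕ.+ m) + x * dsum g (2 ℕ.+ m)) + (- A) * dsum g (1 ℕ.+ m)
    dsum-recurrence m = begin
      term g n₃ 0 + Σ< n₃ (λ j → term g n₃ (suc j))
        ≈⟨ +-cong (leading-recurrence m) (Σ<-cong n₃ (term-recurrence m)) ⟩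
      (H₀ + x * G₀) + Σ< n₃ (λ j → (H j + x * G j) + (- A) * G′ j)
        ≈⟨ +-congˡ (trans (Σ<-+ n₃ (λ j → H j + x * G j) (λ j → (- A) * G′ j))
                         (+-cong (trans (Σ<-+ n₃ H (λ j → x * G j)) (+-congˡ (Σ<-* n₃ x G))) (Σ<-* n₃ (- A) G′))) ⟩
      (H₀ + x * G₀) + ((Σ< n₃ H + x * Σ< n₃ G) + (- A) * Σ< n₃ G′)
        ≈⟨ solve 7 (λ h₀ g₀ x sh sg b sg′ → (h₀ :+ x :* g₀) :+ ((sh :+ x :* sg) :+ b :* sg′) := ((h₀ :+ sh) :+ x :* (g₀ :+ sg)) :+ b :* sg′)
             refl H₀ G₀ x (Σ< n₃ H) (Σ< n₃ G) (- A) (Σ< n₃ G′) ⟩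
      ((H₀ + Σ< n₃ H) + x * (G₀ + Σ< n₃ G)) + (- A) * Σ< n₃ G′
        ≈⟨ +-cong (+-cong (+-congˡ (Σ<-drop-last n₂ H (term-vanishing h n₂ (suc n₂) (n<2[1+n] n₂))))
                          (*-congˡ (+-congˡ (Σ<-drop-last n₂ G (term-vanishing g n₂ (suc n₂) (n<2[1+n] n₂))))))
                  (*-congˡ (Σ<-drop-last n₂ G′ (term-vanishing g n₁ n₂ (n<2[1+n] n₁)))) ⟩
      (dsum h n₂ + x * dsum g n₂) + (- A) * dsum g n₁ ∎
      where
        n₁ n₂ n₃ : ℕ
        n₁ = 1 ℕ.+ m
        n₂ = 2 ℕ.+ m
        n₃ = 3 ℕ.+ m
        H₀ G₀ : Carrier
        H₀ = term h n₂ 0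
        G₀ = term g n₂ 0
        H G G′ : ℕ → Carrier
        H j = term h n₂ (suc j)
        G j = term g n₂ (suc j)
        G′ = term g n₁

  dsum-zero : ∀ n → dsum (λ _ → 0#) n ≈ 0#
  dsum-zero n = Σ<-zero (suc n) (term (λ _ → 0#) n) (λ j → zeroˡ _)

  dsum-1 : ∀ g → dsum g 1 ≈ g 1
  dsum-1 g = begin
    term g 1 0 + (term g 1 1 + 0#)   ≈⟨ +-cong (term-leading g 0) (trans (+-identityʳ _) (term-vanishing g 1 1 (s≤s (s≤s z≤n)))) ⟩
    g 1 + 0#                         ≈⟨ +-identityʳ _ ⟩
    g 1                              ∎

  dsum-2 : ∀ g → dsum g 2 ≈ g 2 + ((1# + 1#) * ((- A) * 1#)) * g 0
  dsum-2 g = begin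
    term g 2 0 + (term g 2 1 + (term g 2 2 + 0#))
      ≈⟨ +-cong (term-leading g 1) (+-cong (*-comm _ _) (trans (+-identityʳ _) (term-vanishing g 2 2 (s≤s (s≤s (s≤s z≤n)))))) ⟩
    g 2 + (ι (e 2 1) * ((- A) * 1#) * g 0 + 0#)
      ≈⟨ +-congˡ (trans (+-identityʳ _) (*-congʳ (*-congʳ (ι-cong middle)))) ⟩
    g 2 + ((1# + 1#) * ((- A) * 1#)) * g 0 ∎

  module FunctionalEquation (u v : Carrier) (uv≈A : u * v ≈ A) where
    x : Carrier
    x = u + v

    -A≈-uv : - A ≈ - (u * v)
    -A≈-uv = -‿cong (sym uv≈A)

    Value : ℕ → Set ℓ
    Value m = dsum (x ^_) (suc m) ≈ u ^ suc m + v ^ suc m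

    Slope : ℕ → Set ℓ
    Slope m = (u - v) * dsum (dpow x) (suc m) ≈ ι (suc m) * (u ^ suc m - v ^ suc m)

    value₁ : Value 0
    value₁ = trans (dsum-1 (x ^_)) (solve 2 (λ u v → (u :+ v) :* con (+ 1) := u :* con (+ 1) :+ v :* con (+ 1)) refl u v)

    value₂ : Value 1
    value₂ = begin
      dsum (x ^_) 2                                        ≈⟨ dsum-2 (x ^_) ⟩
      x * (x * 1#) + ((1# + 1#) * ((- A) * 1#)) * 1#       ≈⟨ +-congˡ (*-congʳ (*-congˡ (*-congʳ -A≈-uv))) ⟩
      x * (x * 1#) + ((1# + 1#) * (- (u * v) * 1#)) * 1#
        ≈⟨ solve 2 (λ u v → (u :+ v) :* ((u :+ v) :* con (+ 1)) :+ (con (+ 2) :* (:- (u :* v) :* con (+ 1))) :* con (+ 1)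
                             := u :* (u :* con (+ 1)) :+ v :* (v :* con (+ 1))) refl u v ⟩
      u ^ 2 + v ^ 2                                        ∎

    slope₁ : Slope 0
    slope₁ = trans (*-congˡ (dsum-1 (dpow x)))
                   (solve 2 (λ u v → (u :- v) :* (con (+ 1) :* con (+ 1)) := con (+ 1) :* (u :* con (+ 1) :- v :* con (+ 1))) refl u v)

    slope₂ : Slope 1
    slope₂ = begin
      (u - v) * dsum (dpow x) 2                                           ≈⟨ *-congˡ (dsum-2 (dpow x)) ⟩
      (u - v) * ((1# + 1#) * (x * 1#) + ((1# + 1#) * ((- A) * 1#)) * 0#)
        ≈⟨ solve 3 (λ u v b → (u :- v) :* (con (+ 2) :* ((u :+ v) :* con (+ 1)) :+ (con (+ 2) :* (b :* con (+ 1))) :* con (+ 0))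
                              := con (+ 2) :* (u :* (u :* con (+ 1)) :- v :* (v :* con (+ 1)))) refl u v (- A) ⟩
      ι 2 * (u ^ 2 - v ^ 2)                                               ∎

    value-step : ∀ m → Value m → Value (suc m) → Value (suc (suc m))
    value-step m value-m value-m+1 = begin
      dsum (x ^_) (3 ℕ.+ m)
        ≈⟨ Recurrence.dsum-recurrence (λ k → sym (+-identityˡ (x * x ^ k))) m ⟩
      (dsum (λ _ → 0#) (2 ℕ.+ m) + x * dsum (x ^_) (2 ℕ.+ m)) + (- A) * dsum (x ^_) (1 ℕ.+ m)
        ≈⟨ +-cong (+-cong (dsum-zero (2 ℕ.+ m)) (*-congˡ value-m+1)) (*-cong -A≈-uv value-m) ⟩
      (0# + x * (u * U + v * V)) + (- (u * v)) * (U + V)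
        ≈⟨ solve 4 (λ u v U V → (con (+ 0) :+ (u :+ v) :* (u :* U :+ v :* V)) :+ (:- (u :* v)) :* (U :+ V)
                                := u :* (u :* U) :+ v :* (v :* V)) refl u v U V ⟩
      u ^ (3 ℕ.+ m) + v ^ (3 ℕ.+ m) ∎
      where
        U V : Carrier
        U = u ^ suc m
        V = v ^ suc m

    slope-step : ∀ m → Value (suc m) → Slope m → Slope (suc m) → Slope (suc (suc m))
    slope-step m value-m+1 slope-m slope-m+1 = begin
      (u - v) * dsum (dpow x) (3 ℕ.+ m)
        ≈⟨ *-congˡ (Recurrence.dsum-recurrence (dpow-suc x) m) ⟩
      (u - v) * ((dsum (x ^_) (2 ℕ.+ m) + x * T₂) + (- A) * T₁)
        ≈⟨ solve 6 (λ u v s t₂ t₁ b → (u :- v) :* ((s :+ (u :+ v) :* t₂) :+ b :* t₁)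
                                      := ((u :- v) :* s :+ (u :+ v) :* ((u :- v) :* t₂)) :+ b :* ((u :- v) :* t₁))
             refl u v (dsum (x ^_) (2 ℕ.+ m)) T₂ T₁ (- A) ⟩
      ((u - v) * dsum (x ^_) (2 ℕ.+ m) + x * ((u - v) * T₂)) + (- A) * ((u - v) * T₁)
        ≈⟨ +-cong (+-cong (*-congˡ value-m+1) (*-congˡ (trans slope-m+1 (*-congʳ (ι-suc (suc m)))))) (*-cong -A≈-uv slope-m) ⟩
      ((u - v) * (u * U + v * V) + x * ((1# + N) * (u * U - v * V))) + (- (u * v)) * (N * (U - V))
        ≈⟨ solve 5 (λ u v U V N → ((u :- v) :* (u :* U :+ v :* V) :+ (u :+ v) :* ((con (+ 1) :+ N) :* (u :* U :- v :* V))) :+ (:- (u :* v)) :* (N :* (U :- V))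
                                  := (con (+ 1) :+ (con (+ 1) :+ N)) :* (u :* (u :* U) :- v :* (v :* V))) refl u v U V N ⟩
      (1# + (1# + N)) * (u ^ (3 ℕ.+ m) - v ^ (3 ℕ.+ m))
        ≈⟨ *-congʳ (sym (trans (ι-suc (2 ℕ.+ m)) (+-congˡ (ι-suc (suc m))))) ⟩
      ι (3 ℕ.+ m) * (u ^ (3 ℕ.+ m) - v ^ (3 ℕ.+ m)) ∎
      where
        T₁ T₂ U V N : Carrier
        T₁ = dsum (dpow x) (1 ℕ.+ m)
        T₂ = dsum (dpow x) (2 ℕ.+ m)
        U = u ^ suc m
        V = v ^ suc m
        N = ι (suc m)

    value-and-slope : ∀ m → (Value m × Slope m) × (Value (suc m) × Slope (suc m))
    value-and-slope zero    = (value₁ , slope₁) , (value₂ , slope₂)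
    value-and-slope (suc m) with value-and-slope m
    ... | (value-m , slope-m) , (value-m+1 , slope-m+1) =
      (value-m+1 , slope-m+1) , (value-step m value-m value-m+1 , slope-step m value-m+1 slope-m slope-m+1)

    value : ∀ m → Value m
    value m = proj₁ (proj₁ (value-and-slope m))

    slope : ∀ m → Slope m
    slope m = proj₂ (proj₁ (value-and-slope m))

module HomomorphismFacts {c ℓ c′ ℓ′} (K : Field c ℓ) (L : Field c′ ℓ′)
                         (f : Field.Carrier K → Field.Carrier L) (hom : IsRingHom K L f) where
  private
    module K  = Field K
    module K′ = FieldOps K
  open Field L
  open FieldOps L
  open RingMorphisms.IsRingHomomorphism hom
  open import Relation.Binary.Reasoning.Setoid setoid

  f-nonzero : ∀ {z} → ¬ (z K.≈ K.0#) → ¬ (f z ≈ 0#)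
  f-nonzero {z} z≉0 fz≈0 with K.inverse z z≉0
  ... | z⁻¹ , zz⁻¹≈1 = 0≉1 (begin
    0#               ≈⟨ sym (zeroˡ (f z⁻¹)) ⟩
    0# * f z⁻¹       ≈⟨ *-congʳ (sym fz≈0) ⟩
    f z * f z⁻¹      ≈⟨ sym (*-homo z z⁻¹) ⟩
    f (z K.* z⁻¹)    ≈⟨ ⟦⟧-cong zz⁻¹≈1 ⟩
    f K.1#           ≈⟨ 1#-homo ⟩
    1#               ∎)

  f-· : ∀ k y → f (k K′.· y) ≈ k · f y
  f-· zero    y = 0#-homo
  f-· (suc k) y = trans (+-homo y (k K′.· y)) (+-congˡ (f-· k y))

  f-^ : ∀ y j → f (y K′.^ j) ≈ f y ^ j
  f-^ y zero    = 1#-homo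
  f-^ y (suc j) = trans (*-homo y (y K′.^ j)) (*-congˡ (f-^ y j))

-- The Dickson polynomial Dₙ(x, a) of K, with coefficients pushed to L by
-- f, evaluates to the Dickson sums of DicksonSums (with A = f(a)): every
-- additive functional on L[x] sending c·xᵏ to g(k)·c — such as evaluation
-- at x (g = x^_) or evaluation of the derivative at x (g = dpow x) —
-- sends Dₙ to Dₙ[g].
module DicksonEvaluation {c ℓ c′ ℓ′} (K : Field c ℓ) (L : Field c′ ℓ′)
                         (f : Field.Carrier K → Field.Carrier L) (hom : IsRingHom K L f)
                         (a : Field.Carrier K) where
  private
    module K  = Field K
    module K′ = FieldOps K
  open Field L
  open FieldOps L
  open IntegerSolver commutativeRing
  open FieldFacts L
  open Polynomials L
  open HomomorphismFacts K L f hom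
  open RingMorphisms.IsRingHomomorphism hom using (+-homo; 0#-homo; -‿homo)
  open DicksonSums L (DicksonCoefficients.dicksonArray K) (f a)
  open import Data.Nat.DivMod using (_/_; m*n/n≡m; /-monoˡ-≤; m/n≤m)
  open import Data.List using (foldr; applyUpTo)
  open import Relation.Binary.Reasoning.Setoid setoid

  ≋-refl : ∀ p → p ≋ p
  ≋-refl []      = []
  ≋-refl (x ∷ p) = refl ∷ ≋-refl p

  map-⊕ : ∀ p q → map f (p K′.⊕ q) ≋ (map f p ⊕ map f q)
  map-⊕ []      q       = ≋-refl _
  map-⊕ (x ∷ p) []      = ≋-refl _
  map-⊕ (x ∷ p) (y ∷ q) = +-homo x y ∷ map-⊕ p q

  map-monomial : ∀ k y → map f (K′.monomial k y) ≋ monomial k (f y)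
  map-monomial zero    y = refl ∷ []
  map-monomial (suc k) y = 0#-homo ∷ map-monomial k y

  f-coeff : ∀ n j → f (K′.dicksonCoeff n j K′.· ((K.- a) K′.^ j)) ≈ coeff n j
  f-coeff n j = begin
    f (K′.dicksonCoeff n j K′.· ((K.- a) K′.^ j))   ≈⟨ f-· (K′.dicksonCoeff n j) _ ⟩
    K′.dicksonCoeff n j · f ((K.- a) K′.^ j)         ≈⟨ ·≈ι* (K′.dicksonCoeff n j) _ ⟩
    ι (K′.dicksonCoeff n j) * f ((K.- a) K′.^ j)     ≈⟨ *-congˡ (trans (f-^ (K.- a) j) (^-cong j (-‿homo a))) ⟩
    coeff n j                                       ∎

  -- the summation range ⌊n/2⌋ + 1 of Defs covers every j with 2j ≤ n
  beyond-half : ∀ n j → suc (n / 2) ≤ j → n < 2 ℕ.* j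
  beyond-half n j n/2<j = ℕₚ.≰⇒> λ 2j≤n → ℕₚ.<⇒≱ n/2<j (j≤n/2 2j≤n)
    where
      j≤n/2 : 2 ℕ.* j ≤ n → j ≤ n / 2
      j≤n/2 2j≤n = ℕₚ.≤-trans (ℕₚ.≤-reflexive (≡.sym (m*n/n≡m j 2)))
                             (/-monoˡ-≤ 2 (ℕₚ.≤-trans (ℕₚ.≤-reflexive (ℕₚ.*-comm j 2)) 2j≤n))

  module Functional (g : ℕ → Carrier) (ev : Poly → Carrier) (ev-[] : ev [] ≈ 0#)
                    (ev-cong : ∀ {p q} → p ≋ q → ev p ≈ ev q)
                    (ev-⊕ : ∀ p q → ev (p ⊕ q) ≈ ev p + ev q)
                    (ev-monomial : ∀ k y → ev (monomial k y) ≈ g k * y) where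

    step : ℕ → ℕ → K′.Poly → K′.Poly
    step n j acc = K′.monomial (n ∸ 2 ℕ.* j) (K′.dicksonCoeff n j K′.· ((K.- a) K′.^ j)) K′.⊕ acc

    ev-step : ∀ n j acc → ev (map f (step n j acc)) ≈ term g n j + ev (map f acc)
    ev-step n j acc = begin
      ev (map f (step n j acc))                          ≈⟨ ev-cong (map-⊕ (K′.monomial (n ∸ 2 ℕ.* j) y) acc) ⟩
      ev (map f (K′.monomial (n ∸ 2 ℕ.* j) y) ⊕ map f acc) ≈⟨ ev-⊕ _ _ ⟩
      ev (map f (K′.monomial (n ∸ 2 ℕ.* j) y)) + ev (map f acc)
        ≈⟨ +-congʳ (trans (ev-cong (map-monomial (n ∸ 2 ℕ.* j) y)) (ev-monomial (n ∸ 2 ℕ.* j) (f y))) ⟩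
      g (n ∸ 2 ℕ.* j) * f y + ev (map f acc)              ≈⟨ +-congʳ (*-congˡ (f-coeff n j)) ⟩
      term g n j + ev (map f acc)                         ∎
      where
        y : K.Carrier
        y = K′.dicksonCoeff n j K′.· ((K.- a) K′.^ j)

    ev-fold : ∀ n B h → ev (map f (foldr (step n) [] (applyUpTo h B))) ≈ Σ< B (λ j → term g n (h j))
    ev-fold n zero    h = ev-[]
    ev-fold n (suc B) h = trans (ev-step n (h 0) _) (+-congˡ (ev-fold n B (λ j → h (suc j))))

    ev-dickson : ∀ n → ev (map f (K′.dickson n a)) ≈ dsum g n
    ev-dickson n = begin
      ev (map f (K′.dickson n a))                  ≈⟨ ev-fold n (suc (n / 2)) (λ j → j) ⟩
      Σ< (suc (n / 2)) (term g n)
        ≈⟨ Σ<-truncate (suc (n / 2)) (n ∸ n / 2) (term g n) (λ j n/2<j → term-vanishing g n j (beyond-half n j n/2<j)) ⟨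
      Σ< (suc (n / 2) ℕ.+ (n ∸ n / 2)) (term g n)  ≡⟨ ≡.cong (λ k → Σ< (suc k) (term g n)) (ℕₚ.m+[n∸m]≡n (m/n≤m n 2)) ⟩
      dsum g n                                     ∎

  dickson-eval : ∀ n x → eval (map f (K′.dickson n a)) x ≈ dsum (x ^_) n
  dickson-eval n x = Functional.ev-dickson (x ^_) (λ p → eval p x) refl (λ p≋q → eval-cong p≋q x)
                                           (λ p q → eval-⊕ p q x) (λ k y → eval-monomial k y x) n

  dickson-deriv : ∀ n x → eval′ (map f (K′.dickson n a)) x ≈ dsum (dpow x) n
  dickson-deriv n x = Functional.ev-dickson (dpow x) (λ p → eval′ p x) refl (λ p≋q → deriv-cong p≋q x)
                                            (λ p q → deriv-⊕ p q x) (λ k y → deriv-monomial k y x) n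

-- Let s² = f(a) and
-- γ = -(-1)ⁿ, so that γ² = 1 and -1 is never a root of τⁿ = γ.  For a root
-- τ of τⁿ = γ put τ⁻¹ = τᵐ·γ, the inverse of τ, which is again a root.  If
-- τ ≠ ±1 then u = sτ and v = sτ⁻¹ satisfy u·v = f(a) and u ≠ v, so by the
-- functional equation x = u + v is a critical point with critical value
-- uⁿ + vⁿ = sⁿγ + sⁿγ, the same for all such τ; two such τ give different
-- points unless they are equal or inverse to each other.  Enough roots
-- exist because L is algebraically closed of characteristic 0; they are
-- collected in inverse-closed pools avoiding 1.
module CriticalPoints {c ℓ c′ ℓ′} (K : Field c ℓ) (charK : FieldOps.CharZero K)
                      (a : Field.Carrier K) (a≉0 : ¬ (Field._≈_ K a (Field.0# K)))
                      (L : Field c′ ℓ′) (closed : FieldOps.AlgebraicallyClosed L)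
                      (f : Field.Carrier K → Field.Carrier L) (hom : IsRingHom K L f)
                      (m : ℕ) where
  private
    module K  = Field K
    module K′ = FieldOps K
  open Field L
  open FieldOps L
  open IntegerSolver commutativeRing
  open FieldFacts L
  open Polynomials L
  open HomomorphismFacts K L f hom
  open DicksonEvaluation K L f hom a
  open DicksonSums L (DicksonCoefficients.dicksonArray K) (f a) using (dsum; module FunctionalEquation)
  open DicksonCritical K L f (suc m) a using (IsCriticalPoint; criticalValue)
  open import Algebra.Properties.Ring ring using (-‿involutive; -0#≈0#)
  open import Relation.Binary.Reasoning.Setoid setoid

  n : ℕ
  n = suc m

  char0 : ∀ k → ¬ (ι (suc k) ≈ 0#)
  char0 k ι[1+k]≈0 = f-nonzero (charK k) (begin
    f (suc k K′.· K.1#)      ≈⟨ f-· (suc k) K.1# ⟩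
    suc k · f K.1#           ≈⟨ ·≈ι* (suc k) (f K.1#) ⟩
    ι (suc k) * f K.1#       ≈⟨ *-congʳ ι[1+k]≈0 ⟩
    0# * f K.1#              ≈⟨ zeroˡ _ ⟩
    0#                       ∎)

  y≈-y⇒y≈0 : ∀ {y} → y ≈ - y → y ≈ 0#
  y≈-y⇒y≈0 {y} y≈-y = cancelˡ (char0 1) (begin
    (1# + 1#) * y      ≈⟨ solve 1 (λ y → con (+ 2) :* y := y :+ y) refl y ⟩
    y + y              ≈⟨ +-congˡ y≈-y ⟩
    y - y              ≈⟨ -‿inverseʳ y ⟩
    0#                 ∎)

  square-root : ∃ λ s → s * s ≈ f a
  square-root with closed (binomial 1 (f a)) (nonconstant 1 (binomial 1 (f a)) (binomial-degree 1 (f a)))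
  ... | s , root = s , trans (*-congˡ (sym (*-identityʳ s)))
                             (x-y≈0⇒x≈y (trans (sym (eval-binomial 1 (f a) s)) root))

  s : Carrier
  s = proj₁ square-root

  s≉0 : ¬ (s ≈ 0#)
  s≉0 s≈0 = f-nonzero a≉0 (trans (sym (proj₂ square-root)) (trans (*-congʳ s≈0) (zeroˡ s)))

  γ : Carrier
  γ = - ((- 1#) ^ n)

  γ²≈1 : γ * γ ≈ 1#
  γ²≈1 = begin
    - ((- 1#) ^ n) * - ((- 1#) ^ n)   ≈⟨ solve 1 (λ y → (:- y) :* (:- y) := y :* y) refl ((- 1#) ^ n) ⟩
    (- 1#) ^ n * (- 1#) ^ n           ≈⟨ sym (^-distrib-* (- 1#) (- 1#) n) ⟩
    (- 1# * - 1#) ^ n                 ≈⟨ ^-cong n (solve 0 (:- con (+ 1) :* :- con (+ 1) := con (+ 1)) refl) ⟩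
    1# ^ n                            ≈⟨ 1^k≈1 n ⟩
    1#                                ∎

  γ≉0 : ¬ (γ ≈ 0#)
  γ≉0 γ≈0 = 0≉1 (trans (sym (trans (*-congʳ γ≈0) (zeroˡ γ))) γ²≈1)

  Root : Carrier → Set ℓ′
  Root τ = τ ^ n ≈ γ

  -- -1 is never a root: (-1)ⁿ = -(-1)ⁿ would force (-1)ⁿ = 0
  -1-not-root : ¬ Root (- 1#)
  -1-not-root root = γ≉0 (trans (-‿cong (y≈-y⇒y≈0 root)) -0#≈0#)

  _⁻¹ : Carrier → Carrier
  τ ⁻¹ = τ ^ m * γ
  infix 10 _⁻¹

  inverse-root : ∀ {τ} → Root τ → τ * τ ⁻¹ ≈ 1#
  inverse-root {τ} root = begin
    τ * (τ ^ m * γ)    ≈⟨ sym (*-assoc τ (τ ^ m) γ) ⟩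
    τ ^ n * γ          ≈⟨ *-congʳ root ⟩
    γ * γ              ≈⟨ γ²≈1 ⟩
    1#                 ∎

  ⁻¹-root : ∀ {τ} → Root τ → Root (τ ⁻¹)
  ⁻¹-root {τ} root = begin
    (τ ⁻¹) ^ n                     ≈⟨ sym (*-identityˡ _) ⟩
    1# * (τ ⁻¹) ^ n                ≈⟨ *-congʳ (sym γ²≈1) ⟩
    (γ * γ) * (τ ⁻¹) ^ n           ≈⟨ *-congʳ (*-congˡ (sym root)) ⟩
    (γ * τ ^ n) * (τ ⁻¹) ^ n       ≈⟨ *-assoc γ _ _ ⟩
    γ * (τ ^ n * (τ ⁻¹) ^ n)       ≈⟨ *-congˡ (sym (^-distrib-* τ (τ ⁻¹) n)) ⟩
    γ * (τ * τ ⁻¹) ^ n             ≈⟨ *-congˡ (trans (^-cong n (inverse-root root)) (1^k≈1 n)) ⟩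
    γ * 1#                         ≈⟨ *-identityʳ γ ⟩
    γ                              ∎

  ⁻¹-swap : ∀ {τ σ} → Root τ → Root σ → τ ⁻¹ ≈ σ → σ ⁻¹ ≈ τ
  ⁻¹-swap {τ} {σ} τ-root σ-root τ⁻¹≈σ =
    inverse-unique (inverse-root σ-root) (trans (*-comm σ τ) (trans (*-congˡ (sym τ⁻¹≈σ)) (inverse-root τ-root)))

  τ≉τ⁻¹ : ∀ {τ} → Root τ → ¬ (τ ≈ 1#) → ¬ (τ ≈ - 1#) → ¬ (τ ≈ τ ⁻¹)
  τ≉τ⁻¹ {τ} root τ≉1 τ≉-1 τ≈τ⁻¹ = *-nonzero (τ≉1 ∘ x-y≈0⇒x≈y) (τ≉-1 ∘ x-y≈0⇒x≈y) (begin
    (τ - 1#) * (τ - - 1#)    ≈⟨ solve 1 (λ τ → (τ :- con (+ 1)) :* (τ :- :- con (+ 1)) := τ :* τ :- con (+ 1)) refl τ ⟩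
    τ * τ - 1#               ≈⟨ +-congʳ (trans (*-congˡ τ≈τ⁻¹) (inverse-root root)) ⟩
    1# - 1#                  ≈⟨ -‿inverseʳ 1# ⟩
    0#                       ∎)

  record Pool : Set (c′ ⊔ ℓ′) where
    field
      members   : List Carrier
      roots     : All Root members
      distinct  : AllPairs (λ σ τ → ¬ (σ ≈ τ)) members
      ⁻¹-closed : All (λ σ → Any (σ ⁻¹ ≈_) members) members
      avoids-1  : ∀ {τ} → Root τ → All (λ σ → ¬ (τ ≈ σ)) members → ¬ (τ ≈ 1#)

  minus-one-power : ∀ k → ((- 1#) ^ k ≈ 1#) ⊎ ((- 1#) ^ k ≈ - 1#)
  minus-one-power zero    = inj₁ refl
  minus-one-power (suc k) with minus-one-power k
  ... | inj₁ even = inj₂ (trans (*-congˡ even) (*-identityʳ _))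
  ... | inj₂ odd  = inj₁ (trans (*-congˡ odd) (solve 0 (:- con (+ 1) :* :- con (+ 1) := con (+ 1)) refl))

  base-pool : ∃ λ (P : Pool) → length (Pool.members P) ≤ 1
  base-pool with minus-one-power n
  ... | inj₁ n-even = record
    { members = [] ; roots = [] ; distinct = [] ; ⁻¹-closed = []
    ; avoids-1 = λ {τ} root _ τ≈1 → 1≉-1 (begin
        1#              ≈⟨ sym (1^k≈1 n) ⟩
        1# ^ n          ≈⟨ ^-cong n (sym τ≈1) ⟩
        τ ^ n           ≈⟨ root ⟩
        - ((- 1#) ^ n)  ≈⟨ -‿cong n-even ⟩
        - 1#            ∎) } , z≤n
    where
      1≉-1 : ¬ (1# ≈ - 1#)
      1≉-1 1≈-1 = 0≉1 (sym (y≈-y⇒y≈0 1≈-1))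
  ... | inj₂ n-odd = record
    { members = [ 1# ] ; roots = 1-root ∷ [] ; distinct = [] ∷ []
    ; ⁻¹-closed = here (trans (*-congʳ (1^k≈1 m)) (trans (*-identityˡ γ) γ≈1)) ∷ []
    ; avoids-1 = λ { _ (τ≉1 ∷ []) → τ≉1 } } , s≤s z≤n
    where
      γ≈1 : γ ≈ 1#
      γ≈1 = trans (-‿cong n-odd) (-‿involutive 1#)
      1-root : Root 1#
      1-root = trans (1^k≈1 n) (sym γ≈1)

  Outside : Pool → Set (c′ ⊔ ℓ′)
  Outside P = ∃ λ τ → Root τ × All (λ σ → ¬ (τ ≈ σ)) (Pool.members P)

  outside-±1 : ∀ P → (o : Outside P) → ¬ (proj₁ o ≈ 1#) × ¬ (proj₁ o ≈ - 1#)
  outside-±1 P (τ , root , fresh) =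
    Pool.avoids-1 P root fresh , λ τ≈-1 → -1-not-root (trans (^-cong n (sym τ≈-1)) root)

  outside : (P : Pool) → length (Pool.members P) ≤ m → Outside P
  outside P |P|≤m = fresh-root closed char0 m γ γ≉0 (Pool.members P) (Pool.roots P) (Pool.distinct P) |P|≤m

  grow : (P : Pool) → Outside P → Pool
  grow P o@(τ , root , fresh) = record
    { members   = τ ∷ τ ⁻¹ ∷ Pool.members P
    ; roots     = root ∷ ⁻¹-root root ∷ Pool.roots P
    ; distinct  = (τ≉τ⁻¹ root τ≉1 τ≉-1 ∷ fresh) ∷ τ⁻¹-fresh ∷ Pool.distinct P
    ; ⁻¹-closed = there (here refl) ∷ here (⁻¹-swap root (⁻¹-root root) refl)
                  ∷ All.map (λ σ⁻¹∈P → there (there σ⁻¹∈P)) (Pool.⁻¹-closed P)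
    ; avoids-1  = λ root′ fresh′ → Pool.avoids-1 P root′ (All.tail (All.tail fresh′))
    }
    where
      τ≉1 : ¬ (τ ≈ 1#)
      τ≉1 = proj₁ (outside-±1 P o)
      τ≉-1 : ¬ (τ ≈ - 1#)
      τ≉-1 = proj₂ (outside-±1 P o)
      -- τ⁻¹ = σ in the pool would put τ = σ⁻¹ in the pool
      τ⁻¹-fresh : All (λ σ → ¬ (τ ⁻¹ ≈ σ)) (Pool.members P)
      τ⁻¹-fresh = All.zipWith
        (λ (σ-root , σ⁻¹∈P) τ⁻¹≈σ →
           let (τ≉ρ , σ⁻¹≈ρ) = All.lookupAny fresh σ⁻¹∈P
           in τ≉ρ (trans (sym (⁻¹-swap root σ-root τ⁻¹≈σ)) σ⁻¹≈ρ))
        (Pool.roots P , Pool.⁻¹-closed P)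

  point : Carrier → Carrier
  point τ = s * τ + s * τ ⁻¹

  V : Carrier
  V = s ^ n * γ + s ^ n * γ

  module Point {τ} (root : Root τ) (τ≉1 : ¬ (τ ≈ 1#)) (τ≉-1 : ¬ (τ ≈ - 1#)) where
    u v : Carrier
    u = s * τ
    v = s * τ ⁻¹

    uv≈A : u * v ≈ f a
    uv≈A = begin
      (s * τ) * (s * τ ⁻¹)    ≈⟨ solve 3 (λ s τ τ′ → (s :* τ) :* (s :* τ′) := (s :* s) :* (τ :* τ′)) refl s τ (τ ⁻¹) ⟩
      (s * s) * (τ * τ ⁻¹)    ≈⟨ *-cong (proj₂ square-root) (inverse-root root) ⟩
      f a * 1#                ≈⟨ *-identityʳ _ ⟩
      f a                     ∎

    open FunctionalEquation u v uv≈A using (value; slope)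

    sⁿγ : ∀ {σ} → Root σ → (s * σ) ^ n ≈ s ^ n * γ
    sⁿγ root′ = trans (^-distrib-* s _ n) (*-congˡ root′)

    critical-value : criticalValue (point τ) ≈ V
    critical-value = begin
      criticalValue (point τ)     ≈⟨ dickson-eval n (point τ) ⟩
      dsum (point τ ^_) n         ≈⟨ value m ⟩
      u ^ n + v ^ n               ≈⟨ +-cong (sⁿγ root) (sⁿγ (⁻¹-root root)) ⟩
      V                           ∎

    u-v≉0 : ¬ (u - v ≈ 0#)
    u-v≉0 u-v≈0 = τ≉τ⁻¹ root τ≉1 τ≉-1 (x-y≈0⇒x≈y (cancelˡ s≉0 (begin
      s * (τ - τ ⁻¹)   ≈⟨ solve 3 (λ s τ τ′ → s :* (τ :- τ′) := s :* τ :- s :* τ′) refl s τ (τ ⁻¹) ⟩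
      u - v            ≈⟨ u-v≈0 ⟩
      0#               ∎)))

    critical : IsCriticalPoint (point τ)
    critical = trans (dickson-deriv n (point τ)) (cancelˡ u-v≉0 (begin
      (u - v) * dsum (dpow (point τ)) n ≈⟨ slope m ⟩
      ι n * (u ^ n - v ^ n)            ≈⟨ *-congˡ (x≈y⇒x-y≈0 (trans (sⁿγ root) (sym (sⁿγ (⁻¹-root root))))) ⟩
      ι n * 0#                         ≈⟨ zeroʳ _ ⟩
      0#                               ∎))

  points-differ : ∀ {τ σ} → Root τ → Root σ → ¬ (σ ≈ τ) → ¬ (σ ≈ τ ⁻¹) → ¬ (point τ ≈ point σ)
  points-differ {τ} {σ} τ-root σ-root σ≉τ σ≉τ⁻¹ same =
    *-nonzero (σ≉τ ∘ sym ∘ x-y≈0⇒x≈y) τσ-1≉0 (begin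
      (τ - σ) * (τ * σ - 1#)
        ≈⟨ solve 4 (λ τ τ′ σ σ′ → (τ :- σ) :* (τ :* σ :- con (+ 1))
                   := (τ :* σ) :* ((τ :+ τ′) :- (σ :+ σ′)) :+ (σ :* (con (+ 1) :- τ :* τ′) :+ τ :* (σ :* σ′ :- con (+ 1))))
             refl τ (τ ⁻¹) σ (σ ⁻¹) ⟩
      (τ * σ) * d + (σ * (1# - τ * τ ⁻¹) + τ * (σ * σ ⁻¹ - 1#))
        ≈⟨ +-cong (*-congˡ d≈0) (+-cong (*-congˡ (x≈y⇒x-y≈0 (sym (inverse-root τ-root))))
                                        (*-congˡ (x≈y⇒x-y≈0 (inverse-root σ-root)))) ⟩
      (τ * σ) * 0# + (σ * 0# + τ * 0#)
        ≈⟨ solve 2 (λ τ σ → (τ :* σ) :* con (+ 0) :+ (σ :* con (+ 0) :+ τ :* con (+ 0)) := con (+ 0)) refl τ σ ⟩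
      0# ∎)
    where
      d : Carrier
      d = (τ + τ ⁻¹) - (σ + σ ⁻¹)
      d≈0 : d ≈ 0#
      d≈0 = cancelˡ s≉0 (begin
        s * d                   ≈⟨ solve 5 (λ s τ τ′ σ σ′ → s :* ((τ :+ τ′) :- (σ :+ σ′)) := (s :* τ :+ s :* τ′) :- (s :* σ :+ s :* σ′)) refl s τ (τ ⁻¹) σ (σ ⁻¹) ⟩
        point τ - point σ       ≈⟨ x≈y⇒x-y≈0 same ⟩
        0#                      ∎)
      τσ-1≉0 : ¬ (τ * σ - 1# ≈ 0#)
      τσ-1≉0 τσ-1≈0 = σ≉τ⁻¹ (inverse-unique (x-y≈0⇒x≈y τσ-1≈0) (inverse-root τ-root))

  critical-at : ∀ P → (o : Outside P) →
                IsCriticalPoint (point (proj₁ o)) × criticalValue (point (proj₁ o)) ≈ V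
  critical-at P o@(τ , root , _) =
    Point.critical root τ≉1 τ≉-1 , Point.critical-value root τ≉1 τ≉-1
    where
      τ≉1 : ¬ (τ ≈ 1#)
      τ≉1 = proj₁ (outside-±1 P o)
      τ≉-1 : ¬ (τ ≈ - 1#)
      τ≉-1 = proj₂ (outside-±1 P o)

  P₀ : Pool
  P₀ = proj₁ base-pool

  |P₀|≤1 : length (Pool.members P₀) ≤ 1
  |P₀|≤1 = proj₂ base-pool

  module TwoPoints (3≤m : 3 ≤ m) where
    τ₁ : Outside P₀
    τ₁ = outside P₀ (ℕₚ.≤-trans |P₀|≤1 (ℕₚ.≤-trans (s≤s z≤n) 3≤m))

    P₁ : Pool
    P₁ = grow P₀ τ₁

    τ₂ : Outside P₁
    τ₂ = outside P₁ (ℕₚ.≤-trans (s≤s (s≤s |P₀|≤1)) 3≤m)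

    x₁ x₂ : Carrier
    x₁ = point (proj₁ τ₁)
    x₂ = point (proj₁ τ₂)

    x₁≉x₂ : ¬ (x₁ ≈ x₂)
    x₁≉x₂ = points-differ (proj₁ (proj₂ τ₁)) (proj₁ (proj₂ τ₂))
                          (All.head (proj₂ (proj₂ τ₂))) (All.head (All.tail (proj₂ (proj₂ τ₂))))

  module ThreePoints (5≤m : 5 ≤ m) where
    open TwoPoints (ℕₚ.≤-trans (s≤s (s≤s (s≤s z≤n))) 5≤m) public

    P₂ : Pool
    P₂ = grow P₁ τ₂

    τ₃ : Outside P₂
    τ₃ = outside P₂ (ℕₚ.≤-trans (s≤s (s≤s (s≤s (s≤s |P₀|≤1)))) 5≤m)

    x₃ : Carrier
    x₃ = point (proj₁ τ₃)

    -- τ₃ avoids τ₂, τ₂⁻¹, τ₁, τ₁⁻¹, in this order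
    τ₃-fresh : All (λ σ → ¬ (proj₁ τ₃ ≈ σ)) (Pool.members P₂)
    τ₃-fresh = proj₂ (proj₂ τ₃)

    x₁≉x₃ : ¬ (x₁ ≈ x₃)
    x₁≉x₃ = points-differ (proj₁ (proj₂ τ₁)) (proj₁ (proj₂ τ₃))
                          (All.head (All.tail (All.tail τ₃-fresh))) (All.head (All.tail (All.tail (All.tail τ₃-fresh))))

    x₂≉x₃ : ¬ (x₂ ≈ x₃)
    x₂≉x₃ = points-differ (proj₁ (proj₂ τ₂)) (proj₁ (proj₂ τ₃))
                          (All.head τ₃-fresh) (All.head (All.tail τ₃-fresh))

  two-points : 3 ≤ m → ∃ λ x → ∃ λ y → ¬ (x ≈ y) ×
               IsCriticalPoint x × IsCriticalPoint y × criticalValue x ≈ criticalValue y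
  two-points 3≤m =
    x₁ , x₂ , x₁≉x₂ , proj₁ (critical-at P₀ τ₁) , proj₁ (critical-at P₁ τ₂) ,
    trans (proj₂ (critical-at P₀ τ₁)) (sym (proj₂ (critical-at P₁ τ₂)))
    where open TwoPoints 3≤m

  three-points : 5 ≤ m → ∃ λ x → ∃ λ y → ∃ λ z →
                 ¬ (x ≈ y) × ¬ (x ≈ z) × ¬ (y ≈ z) ×
                 IsCriticalPoint x × IsCriticalPoint y × IsCriticalPoint z ×
                 criticalValue x ≈ criticalValue y × criticalValue x ≈ criticalValue z
  three-points 5≤m =
    x₁ , x₂ , x₃ , x₁≉x₂ , x₁≉x₃ , x₂≉x₃ ,
    proj₁ (critical-at P₀ τ₁) , proj₁ (critical-at P₁ τ₂) , proj₁ (critical-at P₂ τ₃) ,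
    trans (proj₂ (critical-at P₀ τ₁)) (sym (proj₂ (critical-at P₁ τ₂))) ,
    trans (proj₂ (critical-at P₀ τ₁)) (sym (proj₂ (critical-at P₂ τ₃)))
    where open ThreePoints 5≤m

corollary2p2 : ∀ {c ℓ c′ ℓ′ : Level} (K : Field c ℓ) → FieldOps.CharZero K →
               (a : Field.Carrier K) → ¬ (Field._≈_ K a (Field.0# K)) →
               (L : Field c′ ℓ′) → FieldOps.AlgebraicallyClosed L →
               (f : Field.Carrier K → Field.Carrier L) → IsRingHom K L f →
               (n : ℕ) →
               (4 ≤ n → ∃ λ x → ∃ λ y →
                 ¬ (Field._≈_ L x y) ×
                 DicksonCritical.IsCriticalPoint K L f n a x ×
                 DicksonCritical.IsCriticalPoint K L f n a y ×
                 Field._≈_ L (DicksonCritical.criticalValue K L f n a x)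
                             (DicksonCritical.criticalValue K L f n a y))
               ×
               (6 ≤ n → ∃ λ x → ∃ λ y → ∃ λ z →
                 ¬ (Field._≈_ L x y) × ¬ (Field._≈_ L x z) × ¬ (Field._≈_ L y z) ×
                 DicksonCritical.IsCriticalPoint K L f n a x ×
                 DicksonCritical.IsCriticalPoint K L f n a y ×
                 DicksonCritical.IsCriticalPoint K L f n a z ×
                 Field._≈_ L (DicksonCritical.criticalValue K L f n a x)
                             (DicksonCritical.criticalValue K L f n a y) ×
                 Field._≈_ L (DicksonCritical.criticalValue K L f n a x)
                             (DicksonCritical.criticalValue K L f n a z))
corollary2p2 K charK a a≉0 L closed f hom zero    = (λ ()) , (λ ())
corollary2p2 K charK a a≉0 L closed f hom (suc m) =
  (λ 4≤n → two-points (ℕₚ.≤-pred 4≤n)) , (λ 6≤n → three-points (ℕₚ.≤-pred 6≤n))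
  where open CriticalPoints K charK a a≉0 L closed f hom m
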